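{- Consider a sequence of natural numbers $ t ( n ) $, an integer sequence $ s ( n ) $, four integers $ b_1 \geq 2 $, $b_2 \geq 8$, $ c \geq 0 $ and $ m \geq 2 $ and four polynomials $ A_+ ( z ) $, $ A_- ( z ) $, $ B_+ ( z ) $ and $ B_- ( z ) $ in $ \mathbb{N} [ z ] $. In addition, let $ R $ be the radius of convergence of $ \mathrm{GF}_t ( z ) $ at zero, let $ h = \deg ( B_+ - B_- ) $, let $ E ( n, b ) $ be the expression \[ \left \lfloor \frac{\max\left( b^{n^2 + h n} A_+(b^{ - n}) - b^{n^2 + h n} A_-(b^{ - n}) ,\, 0 \right)}{\max\left( b^{h n} B_+(b^{ - n}) - b^{h n} B_-(b^{ - n}) ,\, 0\right)} \right \rfloor \bmod b^n \] and suppose that: \begin{enumerate} \item some term of $ t ( n ) $ is positive, \item the equality $ t ( r ) = s ( r ) + c^{r + 1} $ holds for every integer $ r \geq 0 $, \item the equality $ \mathrm{GF}_t ( z ) = ( A_+ ( z ) - A_- ( z ) ) / ( B_+ ( z ) - B_- ( z ) ) $ holds, \item the fraction $ ( A_+ ( z ) - A_- ( z ) ) / ( B_+ ( z ) - B_- ( z ) ) $ is irreducible, \item the inequality $ B_- ( 0 ) < B_+ ( 0 ) $ holds, \item the inequality $ b_1^{ - m} < R $ holds, \item the inequality $ t ( r ) < b_1^{r - 2} $ holds for every integer $ r \geq m $. \end{enumerate} Then $ s ( r ) = E ( r , b_1 ) - c^{r + 1} $ for every integer $ r \geq m $. \newline If, instead of conditions 6 and 7, the sequence $ t ( n ) $ satisfies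 the conditions \begin{enumerate}[(a)] \item the inequality $b_2^{ -1} < R$ holds and \item the inequality $t ( r ) < b_2^{r / 3}$ holds for every integer $r \geq 1$, \end{enumerate} then $ s ( r ) = E ( r , b_2 ) - c^{r + 1} $ for every integer $ r \geq 1 $.
   Context: $\mathbb{N}$ denotes the set of non-negative integers; sequences are indexed by $\mathbb{N}$. The generating function $\mathrm{GF}_t(z)$ of a sequence $t(n)$ is the formal power series $\sum_{i\ge 0} t(i) z^i$. The expression $\max(x-y,0)$ is the truncated subtraction of $y$ from $x$. Conventions: $0^0=1$ and $\lfloor x/0\rfloor = 0$, so $x \bmod 0 = x$ and $x \bmod 1 = 0$. -}

module Defs where

open import Data.Bool using (Bool; true; false; _∧_; if_then_else_)
open import Data.Nat as ℕ using (ℕ; zero; suc; _∸_)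
open import Data.Integer as ℤ using (ℤ; +_; -[1+_]; _%ℕ_)
open import Data.Rational as ℚ using (ℚ; mkℚ; 0ℚ; 1ℚ)
open import Data.List using (List; []; _∷_)
open import Data.Product using (Σ; ∃; _×_; _,_)
open import Data.Empty using (⊥)
open import Relation.Binary.PropositionalEquality using (_≡_; _≢_)

sumTo : (ℕ → ℤ) → ℕ → ℤ
sumTo f zero    = f 0
sumTo f (suc n) = sumTo f n ℤ.+ f (suc n)

-- Polynomials are coefficient lists, lowest degree first.
-- ℕ[z] : List ℕ,  ℤ[z] : List ℤ.

coeffℕ : List ℕ → ℕ → ℕ
coeffℕ []       _       = 0
coeffℕ (a ∷ as) zero    = a
coeffℕ (a ∷ as) (suc k) = coeffℕ as k

coeffℤ : List ℤ → ℕ → ℤ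
coeffℤ []       _       = + 0
coeffℤ (a ∷ as) zero    = a
coeffℤ (a ∷ as) (suc k) = coeffℤ as k

polySub : List ℕ → List ℕ → List ℤ
polySub []       []       = []
polySub []       (b ∷ bs) = (+ 0 ℤ.- + b) ∷ polySub [] bs
polySub (a ∷ as) []       = + a ∷ polySub as []
polySub (a ∷ as) (b ∷ bs) = (+ a ℤ.- + b) ∷ polySub as bs

isZeroℤ : ℤ → Bool
isZeroℤ (+ zero) = true
isZeroℤ _        = false

allZero : List ℤ → Bool
allZero []       = true
allZero (a ∷ as) = isZeroℤ a ∧ allZero as

-- degree of an integer polynomial: index of the last nonzero
-- coefficient (0 for the zero polynomial)
degℤ : List ℤ → ℕ
degℤ []       = 0
degℤ (a ∷ as) = if allZero as then 0 else suc (degℤ as)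

mulCoeff : List ℤ → List ℤ → ℕ → ℤ
mulCoeff p q n = sumTo (λ i → coeffℤ p i ℤ.* coeffℤ q (n ∸ i)) n

_∣ₚ_ : List ℤ → List ℤ → Set
d ∣ₚ P = Σ (List ℤ) λ q → ∀ n → coeffℤ P n ≡ mulCoeff d q n

NonConstant : List ℤ → Set
NonConstant d = Σ ℕ λ k → (1 ℕ.≤ k) × (coeffℤ d k ≢ + 0)

IrreducibleFraction : List ℤ → List ℤ → Set
IrreducibleFraction P Q = ∀ d → NonConstant d → d ∣ₚ P → d ∣ₚ Q → ⊥

-- GF_t(z) = P(z) / Q(z) as formal power series, i.e. GF_t(z)·Q(z) = P(z)
-- coefficientwise
GFEquals : (ℕ → ℕ) → List ℤ → List ℤ → Set
GFEquals t P Q = ∀ n → sumTo (λ i → + t (n ∸ i) ℤ.* coeffℤ Q i) n ≡ coeffℤ P n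

fromℕℚ : ℕ → ℚ
fromℕℚ n = + n ℚ./ 1

_^ℚ_ : ℚ → ℕ → ℚ
x ^ℚ zero  = 1ℚ
x ^ℚ suc n = x ℚ.* (x ^ℚ n)

-- 1 / n  (with 1/0 = 0; only used with n ≥ 1)
invℕ : ℕ → ℚ
invℕ zero    = 0ℚ
invℕ (suc k) = + 1 ℚ./ suc k

evalℚ : List ℕ → ℚ → ℚ
evalℚ []       x = 0ℚ
evalℚ (a ∷ as) x = fromℕℚ a ℚ.+ x ℚ.* evalℚ as x

-- ⌊ p / q ⌋ with the convention ⌊ x / 0 ⌋ = 0
floorDiv : ℚ → ℚ → ℤ
floorDiv p (mkℚ (+ zero)    _ _) = + 0
floorDiv p q@(mkℚ (+ suc _) _ _) = ℚ.floor (p ℚ.÷ q)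
floorDiv p q@(mkℚ -[1+ _ ]  _ _) = ℚ.floor (p ℚ.÷ q)

-- x mod n with the convention x mod 0 = x
modℤ : ℤ → ℕ → ℤ
modℤ x zero    = x
modℤ x (suc k) = + (x %ℕ suc k)

E : (A₊ A₋ B₊ B₋ : List ℕ) → ℕ → ℕ → ℤ
E A₊ A₋ B₊ B₋ n b =
  modℤ (floorDiv num den) (b ℕ.^ n)
  where
    h : ℕ
    h = degℤ (polySub B₊ B₋)
    x : ℚ
    x = invℕ (b ℕ.^ n)
    P : ℚ
    P = fromℕℚ (b ℕ.^ (n ℕ.* n ℕ.+ h ℕ.* n))
    Q : ℚ
    Q = fromℕℚ (b ℕ.^ (h ℕ.* n))
    num : ℚ
    num = (P ℚ.* evalℚ A₊ x ℚ.- P ℚ.* evalℚ A₋ x) ℚ.⊔ 0ℚ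
    den : ℚ
    den = (Q ℚ.* evalℚ B₊ x ℚ.- Q ℚ.* evalℚ B₋ x) ℚ.⊔ 0ℚ

-- Radius of convergence.  R = sup { ρ ≥ 0 : (t(n) ρ^n)_n is bounded }
-- (possibly ∞).  For a rational x ≥ 0,  x < R  iff some ρ > x (which may
-- be taken rational) has (t(n) ρ^n)_n bounded.

LessThanRadius : ℚ → (ℕ → ℕ) → Set
LessThanRadius x t =
  Σ ℚ λ ρ → (x ℚ.< ρ) × (Σ ℚ λ C → ∀ n → fromℕℚ (t n) ℚ.* (ρ ^ℚ n) ℚ.≤ C)

-- Put X = bⁿ and x = 1/X. Truncating GF_t · (B₊ - B₋) = A₊ - A₋ at a high degree M gives
-- A(x) = T_M(x) B(x) - e_M(x) with T_M the partial sum of GF_t and e_M → 0 thanks to the growth bounds. Hence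
-- Xⁿ A(x) / B(x) is the base-X number t 0 t 1 … t n followed by the fraction formed by the later digits, which
-- the growth bounds keep in [0, 2/3]; its floor is H = Σ_{k ≤ n} t k X^(n-k) and H mod X = t n. The division is
-- legitimate because B(x) > 0: irreducibility gives a Bézout identity U A + V B = N ≠ 0, which keeps ∣B∣ away
-- from 0 on [0, x], and B(0) > 0.
module Submission where

open import Data.Empty using (⊥; ⊥-elim)
open import Data.List using (List; []; _∷_; length; drop; _++_; replicate)
open import Data.List.Relation.Unary.All using (_∷_)
open import Data.Maybe using (Maybe; just; nothing)
open import Data.Nat as ℕ using (ℕ; zero; suc; z≤n; s≤s)
open import Data.Nat.Induction using (<-rec)
open import Data.Nat.Coprimality using (1-coprimeTo) renaming (sym to csym)
import Data.Nat.DivMod as ℕD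
import Data.Nat.Divisibility as ℕDv
open import Data.Nat.ListAction using (product)
open import Data.Nat.Primality using (Prime; euclidsLemma; prime⇒nonZero; prime⇒nonTrivial)
open import Data.Nat.Primality.Factorisation using (factorise)
import Data.Nat.Properties as ℕₚ
open import Data.Nat.Tactic.RingSolver using () renaming (solve-∀ to ℕ-solve)
open import Data.Integer as ℤ using (ℤ; +_; -[1+_])
open import Data.Integer.Divisibility.Signed as ℤDv using (_∣_; divides; _∣?_)
import Data.Integer.Properties as ℤₚ
open import Data.Integer.Tactic.RingSolver using () renaming (solve-∀ to ℤ-solve)
open import Data.Product using (Σ; _×_; _,_; proj₁; proj₂; ∃)
import Data.Rational as ℚ
import Data.Rational.Properties as ℚₚ
import Data.Rational.Unnormalised as ℚᵘ
import Data.Rational.Unnormalised.Properties as ℚᵘₚ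
open import Data.Sum using (_⊎_; inj₁; inj₂; [_,_]′) renaming (map to ⊎-map)
open import Function using (id)
open import Level using (0ℓ)
open import Relation.Binary.Definitions using (tri<; tri≈; tri>)
open import Relation.Binary.PropositionalEquality
open import Relation.Nullary using (yes; no; ¬_; Dec)
open import Relation.Nullary.Decidable using (¬?; decidable-stable)
open import Tactic.RingSolver using (solve-∀)
import Tactic.RingSolver.Core.AlmostCommutativeRing as ACR

open import Defs

module DigitBounds where
  open import Data.Nat using (_+_; _*_; _^_; _∸_; _≤_; _<_)

  horner : (ℕ → ℕ) → ℕ → ℕ → ℕ
  horner d X zero    = 0
  horner d X (suc K) = X * horner d X K + d K

  tailDigits : (ℕ → ℕ) → ℕ → ℕ → ℕ
  tailDigits t n j = t (n + suc j)

  -- Read Σ t k X⁻ᵏ in base X: t n is a digit, and the digits after it decay geometrically and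
  -- contribute at most 2/3 of a unit in the n-th place. Both growth hypotheses of the theorem reduce to this.
  record TailBounds (t : ℕ → ℕ) (n X : ℕ) : Set where
    field
      1≤n        : 1 ≤ n
      4≤X        : 4 ≤ X
      head<X     : t n < X
      tail-decay : ∀ k → 1 ≤ k → t (n + k) * 2 ^ k ≤ X ^ k
      tail-small : ∀ K → 3 * horner (tailDigits t n) X K ≤ 2 * X ^ K

  private
    2≤2^ : ∀ {k} → 1 ≤ k → 2 ≤ 2 ^ k
    2≤2^ = ℕₚ.^-monoʳ-≤ 2

    b≤b^ : ∀ {b n} .{{_ : ℕ.NonZero b}} → 1 ≤ n → b ≤ b ^ n
    b≤b^ {b} 1≤n = ℕₚ.≤-trans (ℕₚ.≤-reflexive (sym (ℕₚ.*-identityʳ b))) (ℕₚ.^-monoʳ-≤ b 1≤n)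

  -- The slack of the inequality is a polynomial with natural coefficients in b - 2, w - 1, v - 1.
  digit-step-slack : ∀ b w v → 2 ≤ b → 1 ≤ w → 1 ≤ v →
                     b * b * w + 3 * (w * (b * v)) + 3 * (b * v) ≤ 3 * (b * b * w * v) + 4
  digit-step-slack (suc (suc c)) (suc w) (suc v) _ _ _ =
    ℕₚ.≤-trans (ℕₚ.m≤m+n _ (slack c w v)) (ℕₚ.≤-reflexive (expand c w v))
    where
    slack : ℕ → ℕ → ℕ → ℕ
    slack c w v = w * (2 + 6 * v) + c * (2 + 5 * w + 6 * v + 9 * (w * v)) + c * c * ((1 + w) * (2 + 3 * v))
    expand : ∀ c w v →
      (2 + c) * (2 + c) * (1 + w) + 3 * ((1 + w) * ((2 + c) * (1 + v))) + 3 * ((2 + c) * (1 + v))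
        + (w * (2 + 6 * v) + c * (2 + 5 * w + 6 * v + 9 * (w * v)) + c * c * ((1 + w) * (2 + 3 * v)))
      ≡ 3 * ((2 + c) * (2 + c) * (1 + w) * (1 + v)) + 4
    expand = ℕ-solve
  digit-step-slack (suc zero) _ _ (s≤s ()) _ _

  digit-step₁ : ∀ {b w v s u P} → 2 ≤ b → 1 ≤ w → 1 ≤ v →
                3 * s + 3 * v ≤ 2 * P + 1 → u < w * (b * v) →
                3 * (b * b * w * s + u) + 3 * (b * v) ≤ 2 * (b * b * w * P) + 1
  digit-step₁ {b} {w} {v} {s} {u} {P} 2≤b 1≤w 1≤v IH u<wbv =
    ℕₚ.+-cancelʳ-≤ (X * (3 * v) + 3) _ _ (begin
      3 * (X * s + u) + 3 * (b * v) + (X * (3 * v) + 3) ≡⟨ regroup X s u b v ⟩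
      X * (3 * s + 3 * v) + 3 * (1 + u) + 3 * (b * v)   ≤⟨ ℕₚ.+-monoˡ-≤ _ (ℕₚ.+-mono-≤ (ℕₚ.*-monoʳ-≤ X IH) (ℕₚ.*-monoʳ-≤ 3 u<wbv)) ⟩
      X * (2 * P + 1) + 3 * (w * (b * v)) + 3 * (b * v) ≡⟨ regroup′ X P w b v ⟩
      X * (2 * P) + (X + 3 * (w * (b * v)) + 3 * (b * v)) ≤⟨ ℕₚ.+-monoʳ-≤ (X * (2 * P)) (digit-step-slack b w v 2≤b 1≤w 1≤v) ⟩
      X * (2 * P) + (3 * (X * v) + 4)                    ≡⟨ regroup″ X P v ⟩
      2 * (X * P) + 1 + (X * (3 * v) + 3)                ∎)
    where
    open ℕₚ.≤-Reasoning
    X = b * b * w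
    regroup : ∀ X s u b v → 3 * (X * s + u) + 3 * (b * v) + (X * (3 * v) + 3)
                            ≡ X * (3 * s + 3 * v) + 3 * (1 + u) + 3 * (b * v)
    regroup = ℕ-solve
    regroup′ : ∀ X P w b v → X * (2 * P + 1) + 3 * (w * (b * v)) + 3 * (b * v)
                             ≡ X * (2 * P) + (X + 3 * (w * (b * v)) + 3 * (b * v))
    regroup′ = ℕ-solve
    regroup″ : ∀ X P v → X * (2 * P) + (3 * (X * v) + 4) ≡ 2 * (X * P) + 1 + (X * (3 * v) + 3)
    regroup″ = ℕ-solve

  private
    exponent-bound₁ : ∀ n k → 2 ≤ n → 1 ≤ k → n + k ∸ 2 + k ≤ n * k
    exponent-bound₁ (suc (suc n)) (suc k) _ _ =
      ℕₚ.≤-trans (ℕₚ.≤-reflexive (lhs n k)) (ℕₚ.≤-trans (ℕₚ.m≤m+n _ (n * k)) (ℕₚ.≤-reflexive (rhs n k)))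
      where
      lhs : ∀ n k → n + suc k + suc k ≡ 2 + 2 * k + n
      lhs = ℕ-solve
      rhs : ∀ n k → 2 + 2 * k + n + n * k ≡ suc (suc n) * suc k
      rhs = ℕ-solve
    exponent-bound₁ (suc zero) (suc k) (s≤s ()) _

  tailBounds₁ : ∀ {t b n} → 2 ≤ b → 2 ≤ n → (∀ r → n ≤ r → t r < b ^ (r ∸ 2)) →
                TailBounds t n (b ^ n)
  tailBounds₁ {t} {b} {n} 2≤b 2≤n t<b^ = record
    { 1≤n        = 1≤n
    ; 4≤X        = ℕₚ.≤-trans (ℕₚ.^-monoˡ-≤ 2 2≤b) (ℕₚ.^-monoʳ-≤ b 2≤n)
    ; head<X     = ℕₚ.<-≤-trans (t<b^ n ℕₚ.≤-refl) (ℕₚ.^-monoʳ-≤ b (ℕₚ.m∸n≤m n 2))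
    ; tail-decay = decay
    ; tail-small = small
    }
    where
    instance
      b≢0 : ℕ.NonZero b
      b≢0 = ℕ.>-nonZero (ℕₚ.≤-trans (s≤s z≤n) 2≤b)
    1≤n : 1 ≤ n
    1≤n = ℕₚ.≤-trans (s≤s z≤n) 2≤n
    X = b ^ n
    w = b ^ (n ∸ 2)
    S = horner (tailDigits t n) X

    X≡bbw : X ≡ b * b * w
    X≡bbw = trans (cong (b ^_) (sym (ℕₚ.m+[n∸m]≡n 2≤n))) (sym (ℕₚ.*-assoc b b w))

    digit<wbv : ∀ K → t (n + suc K) < w * (b * b ^ K)
    digit<wbv K = subst (t (n + suc K) <_) (trans (cong (b ^_) (ℕₚ.+-∸-comm (suc K) 2≤n)) (ℕₚ.^-distribˡ-+-* b (n ∸ 2) (suc K)))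
                        (t<b^ (n + suc K) (ℕₚ.m≤m+n n (suc K)))

    decay : ∀ k → 1 ≤ k → t (n + k) * 2 ^ k ≤ X ^ k
    decay k 1≤k = begin
      t (n + k) * 2 ^ k         ≤⟨ ℕₚ.*-mono-≤ (ℕₚ.<⇒≤ (t<b^ (n + k) (ℕₚ.m≤m+n n k))) (ℕₚ.^-monoˡ-≤ k 2≤b) ⟩
      b ^ (n + k ∸ 2) * b ^ k   ≡⟨ sym (ℕₚ.^-distribˡ-+-* b (n + k ∸ 2) k) ⟩
      b ^ (n + k ∸ 2 + k)       ≤⟨ ℕₚ.^-monoʳ-≤ b (exponent-bound₁ n k 2≤n 1≤k) ⟩
      b ^ (n * k)               ≡⟨ sym (ℕₚ.^-*-assoc b n k) ⟩
      X ^ k                     ∎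
      where open ℕₚ.≤-Reasoning

    -- The term 3 bᴷ absorbs the strictness of t r < b ^ (r ∸ 2); for b = 2 the bound is attained.
    invariant : ∀ K → 3 * S K + 3 * b ^ K ≤ 2 * X ^ K + 1
    invariant zero    = ℕₚ.≤-refl
    invariant (suc K) =
      subst (λ Y → 3 * (Y * S K + t (n + suc K)) + 3 * (b * b ^ K) ≤ 2 * (Y * X ^ K) + 1) (sym X≡bbw)
            (digit-step₁ 2≤b (ℕₚ.m^n>0 b (n ∸ 2)) (ℕₚ.m^n>0 b K) (invariant K) (digit<wbv K))

    small : ∀ K → 3 * S K ≤ 2 * X ^ K
    small K = ℕₚ.+-cancelʳ-≤ 1 _ _
      (ℕₚ.≤-trans (ℕₚ.+-monoʳ-≤ (3 * S K) (ℕₚ.≤-trans (ℕₚ.m^n>0 b K) (ℕₚ.m≤n*m (b ^ K) 3))) (invariant K))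

  private
    m≤m^3 : ∀ m → m ≤ m ^ 3
    m≤m^3 zero      = z≤n
    m≤m^3 m@(suc _) = ℕₚ.m≤m*n m (m ^ 2)

    ^-cancelˡ-< : ∀ k {u v} → u ^ k < v ^ k → u < v
    ^-cancelˡ-< k uᵏ<vᵏ = ℕₚ.≰⇒> (λ v≤u → ℕₚ.<⇒≱ uᵏ<vᵏ (ℕₚ.^-monoˡ-≤ k v≤u))

    ^3-distribˡ-* : ∀ a c → (a * c) ^ 3 ≡ a ^ 3 * c ^ 3
    ^3-distribˡ-* = expand
      where
      expand : ∀ a c → a * c * (a * c * (a * c * 1)) ≡ a * (a * (a * 1)) * (c * (c * (c * 1)))
      expand = ℕ-solve

    4^≡2^*2^ : ∀ k → 4 ^ k ≡ 2 ^ k * 2 ^ k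
    4^≡2^*2^ zero    = refl
    4^≡2^*2^ (suc k) = trans (cong (4 *_) (4^≡2^*2^ k)) (expand (2 ^ k))
      where
      expand : ∀ a → 4 * (a * a) ≡ 2 * a * (2 * a)
      expand = ℕ-solve

    exponent-bound₂ : ∀ n k → 1 ≤ n → n + suc k + suc (2 * k) ≤ n * (3 * suc k)
    exponent-bound₂ (suc n) k _ =
      ℕₚ.≤-trans (ℕₚ.≤-reflexive (lhs n k)) (ℕₚ.≤-trans (ℕₚ.m≤m+n _ (2 * n + 3 * (n * k))) (ℕₚ.≤-reflexive (rhs n k)))
      where
      lhs : ∀ n k → suc n + suc k + suc (2 * k) ≡ 3 + 3 * k + n
      lhs = ℕ-solve
      rhs : ∀ n k → 3 + 3 * k + n + (2 * n + 3 * (n * k)) ≡ suc n * (3 * suc k)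
      rhs = ℕ-solve

    64^≡8*8^ : ∀ k → 64 ^ suc k ≡ 8 * 8 ^ suc (2 * k)
    64^≡8*8^ k = begin-equality
      64 * 64 ^ k          ≡⟨ cong (64 *_) (ℕₚ.^-*-assoc 8 2 k) ⟩
      64 * 8 ^ (2 * k)     ≡⟨ ℕₚ.*-assoc 8 8 (8 ^ (2 * k)) ⟩
      8 * 8 ^ suc (2 * k)  ∎
      where open ℕₚ.≤-Reasoning

  digit-step₂ : ∀ {X p P s u} → 3 * p * s + 2 * P ≤ 2 * P * p → u * (4 * p) < 2 * (X * P) →
                3 * (4 * p) * (X * s + u) + 2 * (X * P) ≤ 2 * (X * P) * (4 * p)
  digit-step₂ {X} {p} {P} {s} {u} IH u4p<2XP =
    ℕₚ.+-cancelʳ-≤ (8 * (X * P) + 3) _ _ (begin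
      3 * (4 * p) * (X * s + u) + 2 * (X * P) + (8 * (X * P) + 3)  ≡⟨ regroup X p s u P ⟩
      4 * X * (3 * p * s + 2 * P) + 3 * (1 + u * (4 * p)) + 2 * (X * P)
        ≤⟨ ℕₚ.+-monoˡ-≤ (2 * (X * P)) (ℕₚ.+-mono-≤ (ℕₚ.*-monoʳ-≤ (4 * X) IH) (ℕₚ.*-monoʳ-≤ 3 u4p<2XP)) ⟩
      4 * X * (2 * P * p) + 3 * (2 * (X * P)) + 2 * (X * P)        ≤⟨ ℕₚ.m≤m+n _ 3 ⟩
      4 * X * (2 * P * p) + 3 * (2 * (X * P)) + 2 * (X * P) + 3    ≡⟨ regroup′ X P p ⟩
      2 * (X * P) * (4 * p) + (8 * (X * P) + 3)                    ∎)
    where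
    open ℕₚ.≤-Reasoning
    regroup : ∀ X p s u P → 3 * (4 * p) * (X * s + u) + 2 * (X * P) + (8 * (X * P) + 3)
                            ≡ 4 * X * (3 * p * s + 2 * P) + 3 * (1 + u * (4 * p)) + 2 * (X * P)
    regroup = ℕ-solve
    regroup′ : ∀ X P p → 4 * X * (2 * P * p) + 3 * (2 * (X * P)) + 2 * (X * P) + 3
                         ≡ 2 * (X * P) * (4 * p) + (8 * (X * P) + 3)
    regroup′ = ℕ-solve

  tailBounds₂ : ∀ {t b n} → 8 ≤ b → 1 ≤ n → (∀ r → 1 ≤ r → t r ^ 3 < b ^ r) →
                TailBounds t n (b ^ n)
  tailBounds₂ {t} {b} {n} 8≤b 1≤n t³<b^ = record
    { 1≤n        = 1≤n
    ; 4≤X        = ℕₚ.≤-trans (ℕₚ.≤-trans (ℕₚ.m≤n+m 4 4) 8≤b) (b≤b^ 1≤n)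
    ; head<X     = ℕₚ.≤-<-trans (m≤m^3 (t n)) (t³<b^ n 1≤n)
    ; tail-decay = decay
    ; tail-small = small
    }
    where
    instance
      b≢0 : ℕ.NonZero b
      b≢0 = ℕ.>-nonZero (ℕₚ.≤-trans (s≤s z≤n) 8≤b)
    X = b ^ n
    S = horner (tailDigits t n) X

    b^*64^≤8*X^³ : ∀ k → b ^ (n + suc k) * 64 ^ suc k ≤ 8 * (X ^ suc k) ^ 3
    b^*64^≤8*X^³ k = begin
      b ^ (n + suc k) * 64 ^ suc k               ≡⟨ cong (b ^ (n + suc k) *_) (64^≡8*8^ k) ⟩
      b ^ (n + suc k) * (8 * 8 ^ suc (2 * k))    ≤⟨ ℕₚ.*-monoʳ-≤ (b ^ (n + suc k)) (ℕₚ.*-monoʳ-≤ 8 (ℕₚ.^-monoˡ-≤ (suc (2 * k)) 8≤b)) ⟩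
      b ^ (n + suc k) * (8 * b ^ suc (2 * k))    ≡⟨ pull-8 (b ^ (n + suc k)) (b ^ suc (2 * k)) ⟩
      8 * (b ^ (n + suc k) * b ^ suc (2 * k))    ≡⟨ cong (8 *_) (sym (ℕₚ.^-distribˡ-+-* b (n + suc k) (suc (2 * k)))) ⟩
      8 * b ^ (n + suc k + suc (2 * k))          ≤⟨ ℕₚ.*-monoʳ-≤ 8 (ℕₚ.^-monoʳ-≤ b (exponent-bound₂ n k 1≤n)) ⟩
      8 * b ^ (n * (3 * suc k))                  ≡⟨ cong (8 *_) (sym (ℕₚ.^-*-assoc b n (3 * suc k))) ⟩
      8 * X ^ (3 * suc k)                        ≡⟨ cong (λ e → 8 * X ^ e) (ℕₚ.*-comm 3 (suc k)) ⟩
      8 * X ^ (suc k * 3)                        ≡⟨ cong (8 *_) (sym (ℕₚ.^-*-assoc X (suc k) 3)) ⟩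
      8 * (X ^ suc k) ^ 3                        ∎
      where
      open ℕₚ.≤-Reasoning
      pull-8 : ∀ a c → a * (8 * c) ≡ 8 * (a * c)
      pull-8 = ℕ-solve

    scaled-digit : ∀ k → 1 ≤ k → t (n + k) * 4 ^ k < 2 * X ^ k
    scaled-digit k@(suc k′) 1≤k = ^-cancelˡ-< 3 (begin-strict
      (t (n + k) * 4 ^ k) ^ 3     ≡⟨ ^3-distribˡ-* (t (n + k)) (4 ^ k) ⟩
      t (n + k) ^ 3 * (4 ^ k) ^ 3 ≡⟨ cong (t (n + k) ^ 3 *_) 4^k³≡64^k ⟩
      t (n + k) ^ 3 * 64 ^ k      <⟨ ℕₚ.*-monoˡ-< (64 ^ k) {{ℕₚ.m^n≢0 64 k}} (t³<b^ (n + k) (ℕₚ.≤-trans 1≤k (ℕₚ.m≤n+m k n))) ⟩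
      b ^ (n + k) * 64 ^ k        ≤⟨ b^*64^≤8*X^³ k′ ⟩
      8 * (X ^ k) ^ 3             ≡⟨ sym (^3-distribˡ-* 2 (X ^ k)) ⟩
      (2 * X ^ k) ^ 3             ∎)
      where
      open ℕₚ.≤-Reasoning
      4^k³≡64^k : (4 ^ k) ^ 3 ≡ 64 ^ k
      4^k³≡64^k = trans (ℕₚ.^-*-assoc 4 k 3) (trans (cong (4 ^_) (ℕₚ.*-comm k 3)) (sym (ℕₚ.^-*-assoc 4 3 k)))

    decay : ∀ k → 1 ≤ k → t (n + k) * 2 ^ k ≤ X ^ k
    decay k 1≤k = ℕₚ.<⇒≤ (ℕₚ.*-cancelˡ-< 2 _ _ (ℕₚ.≤-<-trans 2u2ᵏ≤u4ᵏ (scaled-digit k 1≤k)))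
      where
      u = t (n + k)
      2u2ᵏ≤u4ᵏ : 2 * (u * 2 ^ k) ≤ u * 4 ^ k
      2u2ᵏ≤u4ᵏ = begin
        2 * (u * 2 ^ k)     ≤⟨ ℕₚ.*-monoˡ-≤ (u * 2 ^ k) (2≤2^ 1≤k) ⟩
        2 ^ k * (u * 2 ^ k) ≡⟨ ℕₚ.*-comm (2 ^ k) (u * 2 ^ k) ⟩
        u * 2 ^ k * 2 ^ k   ≡⟨ ℕₚ.*-assoc u (2 ^ k) (2 ^ k) ⟩
        u * (2 ^ k * 2 ^ k) ≡⟨ cong (u *_) (sym (4^≡2^*2^ k)) ⟩
        u * 4 ^ k           ∎
        where open ℕₚ.≤-Reasoning

    invariant : ∀ K → 3 * 4 ^ K * S K + 2 * X ^ K ≤ 2 * X ^ K * 4 ^ K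
    invariant zero    = ℕₚ.≤-refl
    invariant (suc K) = digit-step₂ {X} {4 ^ K} {X ^ K} (invariant K) (scaled-digit (suc K) (s≤s z≤n))

    small : ∀ K → 3 * S K ≤ 2 * X ^ K
    small K = ℕₚ.*-cancelʳ-≤ _ _ (4 ^ K) {{ℕₚ.m^n≢0 4 K}}
      (ℕₚ.≤-trans (ℕₚ.≤-reflexive (reorder (4 ^ K) (S K))) (ℕₚ.≤-trans (ℕₚ.m≤m+n _ (2 * X ^ K)) (invariant K)))
      where
      reorder : ∀ p s → 3 * s * p ≡ 3 * p * s
      reorder = ℕ-solve

  digitSum : (ℕ → ℕ) → ℕ → ℕ
  digitSum t zero    = t 0
  digitSum t (suc M) = digitSum t M + t (suc M)

  ≤digitSum : ∀ t {i n} → i ≤ n → t i ≤ digitSum t n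
  ≤digitSum t {i} {zero}  z≤n = ℕₚ.≤-refl
  ≤digitSum t {i} {suc n} i≤1+n with ℕₚ.m≤n⇒m<n∨m≡n i≤1+n
  ... | inj₁ i<1+n = ℕₚ.≤-trans (≤digitSum t (ℕₚ.≤-pred i<1+n)) (ℕₚ.m≤m+n _ _)
  ... | inj₂ refl  = ℕₚ.m≤n+m _ _

  module _ {t n X} (tb : TailBounds t n X) where
    open TailBounds tb

    growthConst : ℕ
    growthConst = 2 * digitSum t n + 2 ^ n

    private
      2≤X : 2 ≤ X
      2≤X = ℕₚ.≤-trans (s≤s (s≤s z≤n)) 4≤X

    digit-growth : ∀ M → t (suc M) * 2 ^ suc M ≤ growthConst * X ^ M
    digit-growth M with suc M ℕ.≤? n
    ... | yes 1+M≤n = begin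
      t (suc M) * (2 * 2 ^ M)     ≤⟨ ℕₚ.*-mono-≤ (≤digitSum t 1+M≤n) (ℕₚ.*-monoʳ-≤ 2 (ℕₚ.^-monoˡ-≤ M 2≤X)) ⟩
      digitSum t n * (2 * X ^ M)  ≡⟨ reorder (digitSum t n) (X ^ M) ⟩
      2 * digitSum t n * X ^ M    ≤⟨ ℕₚ.*-monoˡ-≤ (X ^ M) (ℕₚ.m≤m+n (2 * digitSum t n) (2 ^ n)) ⟩
      growthConst * X ^ M         ∎
      where
      open ℕₚ.≤-Reasoning
      reorder : ∀ c p → c * (2 * p) ≡ 2 * c * p
      reorder = ℕ-solve
    ... | no 1+M≰n = begin
      t (suc M) * 2 ^ suc M          ≡⟨ cong (λ m → t m * 2 ^ m) (sym n+k≡1+M) ⟩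
      t (n + k) * 2 ^ (n + k)        ≡⟨ cong (t (n + k) *_) (ℕₚ.^-distribˡ-+-* 2 n k) ⟩
      t (n + k) * (2 ^ n * 2 ^ k)    ≡⟨ reorder (t (n + k)) (2 ^ n) (2 ^ k) ⟩
      t (n + k) * 2 ^ k * 2 ^ n      ≤⟨ ℕₚ.*-monoˡ-≤ (2 ^ n) (tail-decay k 1≤k) ⟩
      X ^ k * 2 ^ n                  ≤⟨ ℕₚ.*-mono-≤ (ℕₚ.^-monoʳ-≤ X {{ℕ.>-nonZero (ℕₚ.≤-trans (s≤s z≤n) 2≤X)}} k≤M) (ℕₚ.m≤n+m (2 ^ n) _) ⟩
      X ^ M * growthConst            ≡⟨ ℕₚ.*-comm (X ^ M) growthConst ⟩
      growthConst * X ^ M            ∎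
      where
      open ℕₚ.≤-Reasoning
      reorder : ∀ a b c → a * (b * c) ≡ a * c * b
      reorder = ℕ-solve
      n<1+M = ℕₚ.≰⇒> 1+M≰n
      k = suc M ∸ n
      n+k≡1+M : n + k ≡ suc M
      n+k≡1+M = ℕₚ.m+[n∸m]≡n (ℕₚ.<⇒≤ n<1+M)
      1≤k : 1 ≤ k
      1≤k = ℕₚ.m<n⇒0<n∸m n<1+M
      k≤M : k ≤ M
      k≤M = ℕₚ.∸-monoʳ-≤ (suc M) 1≤n

    digitSum-growth : ∀ M → 2 * digitSum t M * 2 ^ M ≤ growthConst * X ^ M
    digitSum-growth zero = ℕₚ.≤-trans (ℕₚ.≤-reflexive (ℕₚ.*-identityʳ _))
      (ℕₚ.≤-trans (ℕₚ.*-monoʳ-≤ 2 (≤digitSum t {0} {n} z≤n)) (ℕₚ.≤-trans (ℕₚ.m≤m+n (2 * digitSum t n) (2 ^ n)) (ℕₚ.≤-reflexive (sym (ℕₚ.*-identityʳ _)))))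
    digitSum-growth (suc M) = begin
      2 * (digitSum t M + t (suc M)) * (2 * 2 ^ M)                   ≡⟨ expand (digitSum t M) (t (suc M)) (2 ^ M) ⟩
      2 * (2 * digitSum t M * 2 ^ M) + 2 * (t (suc M) * (2 * 2 ^ M)) ≤⟨ ℕₚ.+-mono-≤ (ℕₚ.*-monoʳ-≤ 2 (digitSum-growth M)) (ℕₚ.*-monoʳ-≤ 2 (digit-growth M)) ⟩
      2 * (growthConst * X ^ M) + 2 * (growthConst * X ^ M)         ≡⟨ double (growthConst * X ^ M) ⟩
      4 * (growthConst * X ^ M)                                     ≤⟨ ℕₚ.*-monoˡ-≤ _ 4≤X ⟩
      X * (growthConst * X ^ M)                                     ≡⟨ swap X growthConst (X ^ M) ⟩
      growthConst * (X * X ^ M)                                     ∎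
      where
      open ℕₚ.≤-Reasoning
      expand : ∀ s u p → 2 * (s + u) * (2 * p) ≡ 2 * (2 * s * p) + 2 * (u * (2 * p))
      expand = ℕ-solve
      double : ∀ a → 2 * a + 2 * a ≡ 4 * a
      double = ℕ-solve
      swap : ∀ x k p → x * (k * p) ≡ k * (x * p)
      swap = ℕ-solve

open DigitBounds using (horner; tailDigits; TailBounds; tailBounds₁; tailBounds₂; digitSum; growthConst; digitSum-growth)

module IntegerPolynomials where
  open import Data.Nat using (_+_; _∸_; _≤_; _<_)
  open import Data.Integer using (_*_)

  sumTo-cong : ∀ {f g} n → (∀ i → i ≤ n → f i ≡ g i) → sumTo f n ≡ sumTo g n
  sumTo-cong zero    f≡g = f≡g 0 z≤n
  sumTo-cong (suc n) f≡g = cong₂ ℤ._+_ (sumTo-cong n (λ i i≤n → f≡g i (ℕₚ.m≤n⇒m≤1+n i≤n))) (f≡g (suc n) ℕₚ.≤-refl)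

  sumTo-suc : ∀ f n → sumTo f (suc n) ≡ f 0 ℤ.+ sumTo (λ i → f (suc i)) n
  sumTo-suc f zero    = refl
  sumTo-suc f (suc n) = trans (cong (ℤ._+ f (suc (suc n))) (sumTo-suc f n)) (ℤₚ.+-assoc (f 0) _ (f (suc (suc n))))

  sumTo-0 : ∀ n → sumTo (λ _ → + 0) n ≡ + 0
  sumTo-0 zero    = refl
  sumTo-0 (suc n) = trans (ℤₚ.+-identityʳ _) (sumTo-0 n)

  sumTo-*ˡ : ∀ c f n → c * sumTo f n ≡ sumTo (λ i → c * f i) n
  sumTo-*ˡ c f zero    = refl
  sumTo-*ˡ c f (suc n) = trans (ℤₚ.*-distribˡ-+ c (sumTo f n) (f (suc n))) (cong (ℤ._+ c * f (suc n)) (sumTo-*ˡ c f n))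

  infixl 6 _+ₚ_
  infixl 7 _·ₚ_ _*ₚ_

  _+ₚ_ : List ℤ → List ℤ → List ℤ
  []      +ₚ q       = q
  (a ∷ p) +ₚ []      = a ∷ p
  (a ∷ p) +ₚ (b ∷ q) = a ℤ.+ b ∷ p +ₚ q

  _·ₚ_ : ℤ → List ℤ → List ℤ
  c ·ₚ []      = []
  c ·ₚ (a ∷ p) = c * a ∷ c ·ₚ p

  _*ₚ_ : List ℤ → List ℤ → List ℤ
  []      *ₚ q = []
  (a ∷ p) *ₚ q = a ·ₚ q +ₚ (+ 0 ∷ p *ₚ q)

  coeff-+ₚ : ∀ p q n → coeffℤ (p +ₚ q) n ≡ coeffℤ p n ℤ.+ coeffℤ q n
  coeff-+ₚ []      q       n       = sym (ℤₚ.+-identityˡ _)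
  coeff-+ₚ (a ∷ p) []      n       = sym (ℤₚ.+-identityʳ _)
  coeff-+ₚ (a ∷ p) (b ∷ q) zero    = refl
  coeff-+ₚ (a ∷ p) (b ∷ q) (suc n) = coeff-+ₚ p q n

  coeff-·ₚ : ∀ c p n → coeffℤ (c ·ₚ p) n ≡ c * coeffℤ p n
  coeff-·ₚ c []      n       = sym (ℤₚ.*-zeroʳ c)
  coeff-·ₚ c (a ∷ p) zero    = refl
  coeff-·ₚ c (a ∷ p) (suc n) = coeff-·ₚ c p n

  coeff-*ₚ : ∀ p q n → coeffℤ (p *ₚ q) n ≡ mulCoeff p q n
  coeff-*ₚ [] q n = sym (trans (sumTo-cong n (λ i _ → ℤₚ.*-zeroˡ (coeffℤ q (n ∸ i)))) (sumTo-0 n))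
  coeff-*ₚ (a ∷ p) q zero = trans (coeff-+ₚ (a ·ₚ q) (+ 0 ∷ p *ₚ q) 0) (trans (ℤₚ.+-identityʳ _) (coeff-·ₚ a q 0))
  coeff-*ₚ (a ∷ p) q (suc n) = begin
    coeffℤ (a ·ₚ q +ₚ (+ 0 ∷ p *ₚ q)) (suc n)       ≡⟨ coeff-+ₚ (a ·ₚ q) (+ 0 ∷ p *ₚ q) (suc n) ⟩
    coeffℤ (a ·ₚ q) (suc n) ℤ.+ coeffℤ (p *ₚ q) n   ≡⟨ cong₂ ℤ._+_ (coeff-·ₚ a q (suc n)) (coeff-*ₚ p q n) ⟩
    a * coeffℤ q (suc n) ℤ.+ mulCoeff p q n         ≡⟨ sym (sumTo-suc _ n) ⟩
    mulCoeff (a ∷ p) q (suc n)                      ∎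
    where open ≡-Reasoning

  mulCoeff-factorˡ : ∀ G G′ P c → (∀ k → coeffℤ G k ≡ c * coeffℤ G′ k) →
                     ∀ n → mulCoeff G P n ≡ c * mulCoeff G′ P n
  mulCoeff-factorˡ G G′ P c G≡cG′ n = trans
    (sumTo-cong n (λ i _ → trans (cong (_* coeffℤ P (n ∸ i)) (G≡cG′ i)) (ℤₚ.*-assoc c (coeffℤ G′ i) _)))
    (sym (sumTo-*ˡ c _ n))

  mulCoeff-factorʳ : ∀ G P P′ c → (∀ k → coeffℤ P k ≡ c * coeffℤ P′ k) →
                     ∀ n → mulCoeff G P n ≡ c * mulCoeff G P′ n
  mulCoeff-factorʳ G P P′ c P≡cP′ n = trans
    (sumTo-cong n (λ i _ → trans (cong (coeffℤ G i *_) (P≡cP′ (n ∸ i))) (swap (coeffℤ G i) c (coeffℤ P′ (n ∸ i)))))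
    (sym (sumTo-*ˡ c _ n))
    where
    swap : ∀ g c p → g * (c * p) ≡ c * (g * p)
    swap = ℤ-solve

  evalℤ : List ℤ → ℤ → ℤ
  evalℤ []      k = + 0
  evalℤ (a ∷ p) k = a ℤ.+ k * evalℤ p k

  1≤∣i∣ : ∀ {i} → i ≢ + 0 → 1 ≤ ℤ.∣ i ∣
  1≤∣i∣ {+ zero}    i≢0 = ⊥-elim (i≢0 refl)
  1≤∣i∣ {+ suc _}   _   = s≤s z≤n
  1≤∣i∣ { -[1+ _ ]} _   = s≤s z≤n

  -- Evaluating at k₀ = 1 + ∣a∣ forces the constant term a to vanish: otherwise ∣a∣ = k₀ ∣p(k₀)∣ ≥ k₀.
  evalℤ≡0⇒coeff≡0 : ∀ p → (∀ k → k ≢ + 0 → evalℤ p k ≡ + 0) → ∀ n → coeffℤ p n ≡ + 0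
  evalℤ≡0⇒coeff≡0 []      _     n       = refl
  evalℤ≡0⇒coeff≡0 (a ∷ p) p≡0   zero    = a≡0
    where
    k₀ = + suc ℤ.∣ a ∣
    a≡-k₀p : a ≡ ℤ.- (k₀ * evalℤ p k₀)
    a≡-k₀p = ℤₚ.i-j≡0⇒i≡j a _ (trans (cong (ℤ._+_ a) (ℤₚ.neg-involutive _)) (p≡0 k₀ (λ ())))
    a≡0 : a ≡ + 0
    a≡0 with evalℤ p k₀ ℤ.≟ + 0
    ... | yes p₀≡0 = trans a≡-k₀p (trans (cong (λ e → ℤ.- (k₀ * e)) p₀≡0) (cong ℤ.-_ (ℤₚ.*-zeroʳ k₀)))
    ... | no  p₀≢0 = ⊥-elim (ℕₚ.<-irrefl refl (begin-strict
      ℤ.∣ a ∣                          <⟨ ℕₚ.n<1+n _ ⟩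
      suc ℤ.∣ a ∣                      ≤⟨ ℕₚ.m≤m*n (suc ℤ.∣ a ∣) _ {{ℕ.>-nonZero (1≤∣i∣ p₀≢0)}} ⟩
      suc ℤ.∣ a ∣ ℕ.* ℤ.∣ evalℤ p k₀ ∣ ≡⟨ sym (trans (cong ℤ.∣_∣ a≡-k₀p) (trans (ℤₚ.∣-i∣≡∣i∣ (k₀ * evalℤ p k₀)) (ℤₚ.abs-* k₀ (evalℤ p k₀)))) ⟩
      ℤ.∣ a ∣                          ∎))
      where open ℕₚ.≤-Reasoning
  evalℤ≡0⇒coeff≡0 (a ∷ p) p≡0 (suc n) = evalℤ≡0⇒coeff≡0 p tail≡0 n
    where
    a≡0 = evalℤ≡0⇒coeff≡0 (a ∷ p) p≡0 zero
    tail≡0 : ∀ k → k ≢ + 0 → evalℤ p k ≡ + 0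
    tail≡0 k k≢0 = ℤₚ.*-cancelˡ-≡ k _ (+ 0) {{ℤ.≢-nonZero k≢0}}
      (trans (sym (trans (cong (ℤ._+ k * evalℤ p k) a≡0) (ℤₚ.+-identityˡ _))) (trans (p≡0 k k≢0) (sym (ℤₚ.*-zeroʳ k))))

  *-≢0 : ∀ {i j} → i ≢ + 0 → j ≢ + 0 → i * j ≢ + 0
  *-≢0 {i} i≢0 j≢0 ij≡0 = [ i≢0 , j≢0 ]′ (ℤₚ.i*j≡0⇒i≡0∨j≡0 i ij≡0)

  ∃prime∣ : ∀ m → 2 ≤ m → ∃ λ p → Prime p × p ℕDv.∣ m
  ∃prime∣ m 2≤m with factorise m {{ℕ.>-nonZero (ℕₚ.≤-trans (s≤s z≤n) 2≤m)}}
  ... | record { factors = [] ; isFactorisation = m≡1 } = ⊥-elim (ℕₚ.<-irrefl refl (ℕₚ.≤-trans 2≤m (ℕₚ.≤-reflexive m≡1)))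
  ... | record { factors = p ∷ ps ; isFactorisation = m≡p*ps ; factorsPrime = p-prime ∷ _ } =
    p , p-prime , ℕDv.divides (product ps) (trans m≡p*ps (ℕₚ.*-comm p (product ps)))

  euclidsLemmaℤ : ∀ {p} i j → Prime p → + p ∣ i * j → + p ∣ i ⊎ + p ∣ j
  euclidsLemmaℤ {p} i j p-prime p∣ij =
    ⊎-map ℤDv.∣ᵤ⇒∣ ℤDv.∣ᵤ⇒∣ (euclidsLemma ℤ.∣ i ∣ ℤ.∣ j ∣ p-prime (subst (p ℕDv.∣_) (ℤₚ.abs-* i j) (ℤDv.∣⇒∣ᵤ p∣ij)))

  ∣sumTo : ∀ {k} f n → (∀ i → i ≤ n → k ∣ f i) → k ∣ sumTo f n
  ∣sumTo f zero    k∣f = k∣f 0 z≤n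
  ∣sumTo f (suc n) k∣f = ℤDv.∣m∣n⇒∣m+n (∣sumTo f n (λ i i≤n → k∣f i (ℕₚ.m≤n⇒m≤1+n i≤n))) (k∣f (suc n) ℕₚ.≤-refl)

  ∣sumTo⇒∣term : ∀ {k} f n i → i ≤ n → (∀ j → j ≤ n → j ≢ i → k ∣ f j) → k ∣ sumTo f n → k ∣ f i
  ∣sumTo⇒∣term f zero .zero z≤n _ k∣sum = k∣sum
  ∣sumTo⇒∣term f (suc n) i i≤1+n k∣others k∣sum with i ℕ.≟ suc n
  ... | yes refl = ℤDv.∣m+n∣m⇒∣n k∣sum (∣sumTo f n (λ j j≤n → k∣others j (ℕₚ.m≤n⇒m≤1+n j≤n) (λ { refl → ℕₚ.<-irrefl refl (s≤s j≤n) })))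
  ... | no  i≢1+n = ∣sumTo⇒∣term f n i (ℕₚ.≤-pred (ℕₚ.≤∧≢⇒< i≤1+n i≢1+n)) (λ j j≤n → k∣others j (ℕₚ.m≤n⇒m≤1+n j≤n))
                      (ℤDv.∣m+n∣n⇒∣m k∣sum (k∣others (suc n) ℕₚ.≤-refl (λ 1+n≡i → i≢1+n (sym 1+n≡i))))

  private
    search-below : ∀ {Q : ℕ → Set} → (∀ n → Dec (Q n)) → ∀ b →
                   (∀ k → k < b → ¬ Q k) ⊎ ∃ λ i → Q i × (∀ k → k < i → ¬ Q k)
    search-below Q? zero = inj₁ (λ _ ())
    search-below Q? (suc b) with search-below Q? b | Q? b
    ... | inj₂ found | _      = inj₂ found
    ... | inj₁ none  | yes Qb = inj₂ (b , Qb , none)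
    ... | inj₁ none  | no ¬Qb = inj₁ (λ k k<1+b → [ none k , (λ { refl → ¬Qb }) ]′ (ℕₚ.m≤n⇒m<n∨m≡n (ℕₚ.≤-pred k<1+b)))

  least : ∀ {Q : ℕ → Set} → (∀ n → Dec (Q n)) → ∀ {j} → Q j → ∃ λ i → Q i × (∀ k → k < i → ¬ Q k)
  least Q? {j} Qj = [ (λ none → ⊥-elim (none j ℕₚ.≤-refl Qj)) , (λ found → found) ]′ (search-below Q? (suc j))

  -- Take the first coefficient g_{i₀} of G not divisible by p; the coefficient of index i₀ + j of G P is
  -- g_{i₀} P_j plus terms divisible by p (by minimality of i₀ and by strong induction on j).
  gauss-lemma : ∀ {p} G P → Prime p → (∃ λ i → ¬ (+ p ∣ coeffℤ G i)) →
                (∀ n → + p ∣ mulCoeff G P n) → ∀ j → + p ∣ coeffℤ P j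
  gauss-lemma {p} G P p-prime (_ , p∤g) p∣GP = <-rec (λ j → + p ∣ coeffℤ P j) step
    where
    first = least (λ k → ¬? (+ p ∣? coeffℤ G k)) p∤g
    i₀ = proj₁ first
    p∤gᵢ₀ = proj₁ (proj₂ first)
    p∣g<i₀ : ∀ {k} → k < i₀ → + p ∣ coeffℤ G k
    p∣g<i₀ {k} k<i₀ = decidable-stable (+ p ∣? coeffℤ G k) (proj₂ (proj₂ first) k k<i₀)
    step : ∀ j → (∀ {j′} → j′ < j → + p ∣ coeffℤ P j′) → + p ∣ coeffℤ P j
    step j p∣P<j = [ (λ p∣gᵢ₀ → ⊥-elim (p∤gᵢ₀ p∣gᵢ₀)) , subst (λ k → + p ∣ coeffℤ P k) (ℕₚ.m+n∸m≡n i₀ j) ]′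
                     (euclidsLemmaℤ _ _ p-prime p∣gᵢ₀Pⱼ)
      where
      n = i₀ + j
      term : ℕ → ℤ
      term k = coeffℤ G k * coeffℤ P (n ∸ k)
      p∣other : ∀ k → k ≤ n → k ≢ i₀ → + p ∣ term k
      p∣other k k≤n k≢i₀ with ℕₚ.<-cmp k i₀
      ... | tri< k<i₀ _ _ = ℤDv.∣m⇒∣m*n (coeffℤ P (n ∸ k)) (p∣g<i₀ k<i₀)
      ... | tri≈ _ k≡i₀ _ = ⊥-elim (k≢i₀ k≡i₀)
      ... | tri> _ _ i₀<k = ℤDv.∣n⇒∣m*n (coeffℤ G k) (p∣P<j (subst (n ∸ k <_) (ℕₚ.m+n∸m≡n i₀ j) (ℕₚ.∸-monoʳ-< i₀<k k≤n)))
      p∣gᵢ₀Pⱼ : + p ∣ term i₀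
      p∣gᵢ₀Pⱼ = ∣sumTo⇒∣term term n i₀ (ℕₚ.m≤m+n i₀ j) p∣other (p∣GP n)

  all-divisible? : ∀ p G → (∀ k → + p ∣ coeffℤ G k) ⊎ ∃ λ k → ¬ (+ p ∣ coeffℤ G k)
  all-divisible? p [] = inj₁ (λ _ → divides (+ 0) refl)
  all-divisible? p (g ∷ G) with + p ∣? g | all-divisible? p G
  ... | no  p∤g | _              = inj₂ (0 , p∤g)
  ... | yes _   | inj₂ (k , p∤)  = inj₂ (suc k , p∤)
  ... | yes p∣g | inj₁ p∣G       = inj₁ (λ { zero → p∣g ; (suc k) → p∣G k })

  divide-coeffs : ∀ p G → (∀ k → + p ∣ coeffℤ G k) → ∃ λ G′ → ∀ k → coeffℤ G k ≡ + p * coeffℤ G′ k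
  divide-coeffs p []      _   = [] , λ _ → sym (ℤₚ.*-zeroʳ (+ p))
  divide-coeffs p (g ∷ G) p∣G with p∣G 0 | divide-coeffs p G (λ k → p∣G (suc k))
  ... | divides q g≡qp | G′ , G≡pG′ = q ∷ G′ , λ { zero → trans g≡qp (ℤₚ.*-comm q (+ p)) ; (suc k) → G≡pG′ k }

  infix 4 _∣[_·_]

  record _∣[_·_] (G : List ℤ) (c : ℤ) (A : List ℤ) : Set where
    constructor cofactor
    field
      Q     : List ℤ
      GQ≡cA : ∀ n → mulCoeff G Q n ≡ c * coeffℤ A n

  record CommonFactor (α : ℤ) (A : List ℤ) (β : ℤ) (B : List ℤ) : Set where
    constructor commonFactor
    field
      G        : List ℤ
      nonConst : NonConstant G
      G∣αA     : G ∣[ α · A ]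
      G∣βB     : G ∣[ β · B ]

  divide-out-prime : ∀ {p α A β B} → Prime p → CommonFactor (α * + p) A β B → CommonFactor α A β B
  divide-out-prime {p} {α} {A} {β} {B} p-prime (commonFactor G (k , 1≤k , gₖ≢0) (cofactor P GP≡αpA) (cofactor Q GQ≡βB)) =
    [ p∣G-case , p∤G-case ]′ (all-divisible? p G)
    where
    instance
      p≢0 : ℕ.NonZero p
      p≢0 = prime⇒nonZero p-prime
    cancel-p : ∀ {i j} → + p * i ≡ + p * j → i ≡ j
    cancel-p = ℤₚ.*-cancelˡ-≡ (+ p) _ _
    GP≡p[αA] : ∀ n → mulCoeff G P n ≡ + p * (α * coeffℤ A n)
    GP≡p[αA] n = trans (GP≡αpA n) (reassoc α (+ p) (coeffℤ A n))
      where
      reassoc : ∀ a p c → a * p * c ≡ p * (a * c)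
      reassoc = ℤ-solve

    p∣G-case : (∀ i → + p ∣ coeffℤ G i) → CommonFactor α A β B
    p∣G-case p∣G = commonFactor G′ (k , 1≤k , g′ₖ≢0) (cofactor P G′P≡αA) (cofactor (+ p ·ₚ Q) G′pQ≡βB)
      where
      G′ = proj₁ (divide-coeffs p G p∣G)
      G≡pG′ = proj₂ (divide-coeffs p G p∣G)
      g′ₖ≢0 : coeffℤ G′ k ≢ + 0
      g′ₖ≢0 g′ₖ≡0 = gₖ≢0 (trans (G≡pG′ k) (trans (cong (+ p *_) g′ₖ≡0) (ℤₚ.*-zeroʳ (+ p))))
      G′P≡αA : ∀ n → mulCoeff G′ P n ≡ α * coeffℤ A n
      G′P≡αA n = cancel-p (trans (sym (mulCoeff-factorˡ G G′ P (+ p) G≡pG′ n)) (GP≡p[αA] n))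
      G′pQ≡βB : ∀ n → mulCoeff G′ (+ p ·ₚ Q) n ≡ β * coeffℤ B n
      G′pQ≡βB n = trans (mulCoeff-factorʳ G′ (+ p ·ₚ Q) Q (+ p) (coeff-·ₚ (+ p) Q) n)
                        (trans (sym (mulCoeff-factorˡ G G′ Q (+ p) G≡pG′ n)) (GQ≡βB n))

    p∤G-case : (∃ λ i → ¬ (+ p ∣ coeffℤ G i)) → CommonFactor α A β B
    p∤G-case p∤G = commonFactor G (k , 1≤k , gₖ≢0) (cofactor P′ GP′≡αA) (cofactor Q GQ≡βB)
      where
      p∣P : ∀ j → + p ∣ coeffℤ P j
      p∣P = gauss-lemma G P p-prime p∤G (λ n → subst (+ p ∣_) (sym (GP≡p[αA] n)) (ℤDv.∣m⇒∣m*n _ ℤDv.∣-refl))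
      P′ = proj₁ (divide-coeffs p P p∣P)
      GP′≡αA : ∀ n → mulCoeff G P′ n ≡ α * coeffℤ A n
      GP′≡αA n = cancel-p (trans (sym (mulCoeff-factorʳ G P P′ (+ p) (proj₂ (divide-coeffs p P p∣P)) n)) (GP≡p[αA] n))

  private
    unit² : ∀ {i} → i ≢ + 0 → ℤ.∣ i ∣ ≤ 1 → i * i ≡ + 1
    unit² {+ zero}         i≢0 _             = ⊥-elim (i≢0 refl)
    unit² {+ suc zero}     _   _             = refl
    unit² {+ suc (suc _)}  _   (s≤s ())
    unit² { -[1+ zero ]}   _   _             = refl
    unit² { -[1+ suc _ ]}  _   (s≤s ())

  remove-content : ∀ fuel {α A β B} → ℤ.∣ α ∣ < fuel → α ≢ + 0 → CommonFactor α A β B → CommonFactor (+ 1) A β B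
  remove-content (suc fuel) {α} {A} {β} {B} ∣α∣<1+fuel α≢0 (commonFactor G nc (cofactor P GP≡αA) G∣βB) =
    by-size (ℤ.∣ α ∣ ℕ.≤? 1)
    where
    by-size : Dec (ℤ.∣ α ∣ ≤ 1) → CommonFactor (+ 1) A β B
    by-size (yes ∣α∣≤1) = commonFactor G nc (cofactor (α ·ₚ P) GαP≡A) G∣βB
      where
      GαP≡A : ∀ n → mulCoeff G (α ·ₚ P) n ≡ + 1 * coeffℤ A n
      GαP≡A n = begin
        mulCoeff G (α ·ₚ P) n      ≡⟨ mulCoeff-factorʳ G (α ·ₚ P) P α (coeff-·ₚ α P) n ⟩
        α * mulCoeff G P n         ≡⟨ cong (α *_) (GP≡αA n) ⟩
        α * (α * coeffℤ A n)       ≡⟨ sym (ℤₚ.*-assoc α α (coeffℤ A n)) ⟩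
        α * α * coeffℤ A n         ≡⟨ cong (_* coeffℤ A n) (unit² α≢0 ∣α∣≤1) ⟩
        + 1 * coeffℤ A n           ∎
        where open ≡-Reasoning
    by-size (no ∣α∣≰1) = remove-content fuel ∣α′∣<fuel α′≢0
                           (divide-out-prime p-prime (commonFactor G nc (cofactor P (λ n → trans (GP≡αA n) (cong (_* coeffℤ A n) α≡α′p))) G∣βB))
      where
      prime-factor = ∃prime∣ ℤ.∣ α ∣ (ℕₚ.≰⇒> ∣α∣≰1)
      p = proj₁ prime-factor
      p-prime = proj₁ (proj₂ prime-factor)
      p∣α : + p ∣ α
      p∣α = ℤDv.∣ᵤ⇒∣ (proj₂ (proj₂ prime-factor))
      α′ = ℤDv._∣_.quotient p∣α
      α≡α′p : α ≡ α′ * + p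
      α≡α′p = ℤDv._∣_.equality p∣α
      α′≢0 : α′ ≢ + 0
      α′≢0 α′≡0 = α≢0 (trans α≡α′p (trans (cong (_* + p) α′≡0) (ℤₚ.*-zeroˡ (+ p))))
      ∣α′∣<fuel : ℤ.∣ α′ ∣ < fuel
      ∣α′∣<fuel = ℕₚ.<-≤-trans (subst (ℤ.∣ α′ ∣ <_) (sym (trans (cong ℤ.∣_∣ α≡α′p) (ℤₚ.abs-* α′ (+ p))))
                    (ℕₚ.m<m*n ℤ.∣ α′ ∣ p {{ℕ.>-nonZero (1≤∣i∣ α′≢0)}} (ℕ.nonTrivial⇒n>1 p {{prime⇒nonTrivial p-prime}})))
                    (ℕₚ.≤-pred ∣α∣<1+fuel)

  -- Gauss's lemma lets us clear the scalars α and β one prime at a time.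
  common-factor : ∀ {α A β B} → α ≢ + 0 → β ≢ + 0 → CommonFactor α A β B → ∃ λ D → NonConstant D × D ∣ₚ A × D ∣ₚ B
  common-factor α≢0 β≢0 cf =
    let commonFactor G₁ nc₁ G₁∣A G₁∣βB = remove-content _ ℕₚ.≤-refl α≢0 cf
        commonFactor G₂ nc₂ G₂∣B G₂∣A  = remove-content _ ℕₚ.≤-refl β≢0 (commonFactor G₁ nc₁ G₁∣βB G₁∣A)
    in G₂ , nc₂ , ∣ₚ-from G₂∣A , ∣ₚ-from G₂∣B
    where
    ∣ₚ-from : ∀ {D C} → D ∣[ + 1 · C ] → D ∣ₚ C
    ∣ₚ-from (cofactor Q DQ≡C) = Q , λ n → sym (trans (DQ≡C n) (ℤₚ.*-identityˡ _))

module RationalPolynomials where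
  open ℚ using (ℚ; mkℚ; 0ℚ; 1ℚ; ½; _+_; _*_; _-_; -_; _≤_; _<_; ∣_∣)
  open IntegerPolynomials

  ℚ-ring : ACR.AlmostCommutativeRing 0ℓ 0ℓ
  ℚ-ring = ACR.fromCommutativeRing ℚₚ.+-*-commutativeRing 0≡?
    where
    0≡? : ∀ x → Maybe (0ℚ ≡ x)
    0≡? x with 0ℚ ℚₚ.≟ x
    ... | yes 0≡x = just 0≡x
    ... | no  _   = nothing

  fromℤ : ℤ → ℚ
  fromℤ i = mkℚ i 0 (csym (1-coprimeTo _))

  fromℕ : ℕ → ℚ
  fromℕ n = fromℤ (+ n)

  fromℤ-+ : ∀ i j → fromℤ (i ℤ.+ j) ≡ fromℤ i + fromℤ j
  fromℤ-+ i j = ℚₚ.toℚᵘ-injective (ℚᵘₚ.≃-trans (ℚᵘ.*≡* (expand i j)) (ℚᵘₚ.≃-sym (ℚₚ.toℚᵘ-homo-+ (fromℤ i) (fromℤ j))))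
    where
    expand : ∀ i j → (i ℤ.+ j) ℤ.* + 1 ≡ (i ℤ.* + 1 ℤ.+ j ℤ.* + 1) ℤ.* + 1
    expand = ℤ-solve

  fromℤ-* : ∀ i j → fromℤ (i ℤ.* j) ≡ fromℤ i * fromℤ j
  fromℤ-* i j = ℚₚ.toℚᵘ-injective (ℚᵘₚ.≃-trans (ℚᵘ.*≡* (expand i j)) (ℚᵘₚ.≃-sym (ℚₚ.toℚᵘ-homo-* (fromℤ i) (fromℤ j))))
    where
    expand : ∀ i j → i ℤ.* j ℤ.* + 1 ≡ i ℤ.* j ℤ.* + 1
    expand = ℤ-solve

  fromℤ-neg : ∀ i → fromℤ (ℤ.- i) ≡ - fromℤ i
  fromℤ-neg i = ℚₚ.toℚᵘ-injective (ℚᵘₚ.≃-trans (ℚᵘ.*≡* refl) (ℚᵘₚ.≃-sym (ℚₚ.toℚᵘ-homo‿- (fromℤ i))))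

  fromℤ-injective : ∀ {i j} → fromℤ i ≡ fromℤ j → i ≡ j
  fromℤ-injective refl = refl

  fromℤ-mono-≤ : ∀ {i j} → i ℤ.≤ j → fromℤ i ≤ fromℤ j
  fromℤ-mono-≤ {i} {j} i≤j = ℚ.*≤* (subst₂ ℤ._≤_ (sym (ℤₚ.*-identityʳ i)) (sym (ℤₚ.*-identityʳ j)) i≤j)

  fromℤ-mono-< : ∀ {i j} → i ℤ.< j → fromℤ i < fromℤ j
  fromℤ-mono-< {i} {j} i<j = ℚ.*<* (subst₂ ℤ._<_ (sym (ℤₚ.*-identityʳ i)) (sym (ℤₚ.*-identityʳ j)) i<j)

  fromℕℚ≡fromℕ : ∀ n → fromℕℚ n ≡ fromℕ n
  fromℕℚ≡fromℕ n = ℚₚ.↥p/↧p≡p (fromℕ n)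

  fromℕ-+ : ∀ m n → fromℕ (m ℕ.+ n) ≡ fromℕ m + fromℕ n
  fromℕ-+ m n = trans (cong fromℤ (ℤₚ.pos-+ m n)) (fromℤ-+ (+ m) (+ n))

  fromℕ-* : ∀ m n → fromℕ (m ℕ.* n) ≡ fromℕ m * fromℕ n
  fromℕ-* m n = trans (cong fromℤ (ℤₚ.pos-* m n)) (fromℤ-* (+ m) (+ n))

  fromℕ-mono-≤ : ∀ {m n} → m ℕ.≤ n → fromℕ m ≤ fromℕ n
  fromℕ-mono-≤ m≤n = fromℤ-mono-≤ (ℤ.+≤+ m≤n)

  fromℕ-mono-< : ∀ {m n} → m ℕ.< n → fromℕ m < fromℕ n
  fromℕ-mono-< m<n = fromℤ-mono-< (ℤ.+<+ m<n)

  fromℕ-nonNeg : ∀ n → 0ℚ ≤ fromℕ n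
  fromℕ-nonNeg n = fromℕ-mono-≤ z≤n

  0≤1 : 0ℚ ≤ 1ℚ
  0≤1 = fromℕ-nonNeg 1

  0<1 : 0ℚ < 1ℚ
  0<1 = fromℕ-mono-< (s≤s z≤n)

  0≤q-p⇒p≤q : ∀ {p q} → 0ℚ ≤ q - p → p ≤ q
  0≤q-p⇒p≤q {p} {q} 0≤q-p = subst₂ _≤_ (ℚₚ.+-identityʳ p) (p+[q-p]≡q p q) (ℚₚ.+-monoʳ-≤ p 0≤q-p)
    where
    p+[q-p]≡q : ∀ p q → p + (q - p) ≡ q
    p+[q-p]≡q = solve-∀ ℚ-ring

  p≤q⇒0≤q-p : ∀ {p q} → p ≤ q → 0ℚ ≤ q - p
  p≤q⇒0≤q-p {p} {q} p≤q = subst (_≤ q - p) (ℚₚ.+-inverseʳ p) (ℚₚ.+-monoˡ-≤ (- p) p≤q)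

  0<q-p⇒p<q : ∀ {p q} → 0ℚ < q - p → p < q
  0<q-p⇒p<q {p} {q} 0<q-p = subst₂ _<_ (ℚₚ.+-identityʳ p) (p+[q-p]≡q p q) (ℚₚ.+-monoʳ-< p 0<q-p)
    where
    p+[q-p]≡q : ∀ p q → p + (q - p) ≡ q
    p+[q-p]≡q = solve-∀ ℚ-ring

  p<q⇒0<q-p : ∀ {p q} → p < q → 0ℚ < q - p
  p<q⇒0<q-p {p} {q} p<q = subst (_< q - p) (ℚₚ.+-inverseʳ p) (ℚₚ.+-monoˡ-< (- p) p<q)

  +-nonNeg : ∀ {p q} → 0ℚ ≤ p → 0ℚ ≤ q → 0ℚ ≤ p + q
  +-nonNeg {p} {q} 0≤p 0≤q = subst (_≤ p + q) (ℚₚ.+-identityʳ 0ℚ) (ℚₚ.+-mono-≤ 0≤p 0≤q)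

  *-nonNeg : ∀ {p q} → 0ℚ ≤ p → 0ℚ ≤ q → 0ℚ ≤ p * q
  *-nonNeg {p} {q} 0≤p 0≤q = subst (_≤ p * q) (ℚₚ.*-zeroʳ p) (ℚₚ.*-monoˡ-≤-nonNeg p {{ℚ.nonNegative 0≤p}} 0≤q)

  *-pos : ∀ {p q} → 0ℚ < p → 0ℚ < q → 0ℚ < p * q
  *-pos {p} {q} 0<p 0<q = subst (_< p * q) (ℚₚ.*-zeroʳ p) (ℚₚ.*-monoʳ-<-pos p {{ℚ.positive 0<p}} 0<q)

  *-monoˡ-≤-0≤ : ∀ {p q} r → 0ℚ ≤ r → p ≤ q → r * p ≤ r * q
  *-monoˡ-≤-0≤ r 0≤r = ℚₚ.*-monoˡ-≤-nonNeg r {{ℚ.nonNegative 0≤r}}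

  *-monoʳ-≤-0≤ : ∀ {p q} r → 0ℚ ≤ r → p ≤ q → p * r ≤ q * r
  *-monoʳ-≤-0≤ r 0≤r = ℚₚ.*-monoʳ-≤-nonNeg r {{ℚ.nonNegative 0≤r}}

  *-mono-≤-0≤ : ∀ {p q r s} → 0ℚ ≤ p → 0ℚ ≤ r → p ≤ q → r ≤ s → p * r ≤ q * s
  *-mono-≤-0≤ {p} {q} {r} {s} 0≤p 0≤r p≤q r≤s =
    ℚₚ.≤-trans (*-monoˡ-≤-0≤ p 0≤p r≤s) (*-monoʳ-≤-0≤ s (ℚₚ.≤-trans 0≤r r≤s) p≤q)

  p≤∣p∣ : ∀ p → p ≤ ∣ p ∣
  p≤∣p∣ p with ℚₚ.≤-total 0ℚ p
  ... | inj₁ 0≤p = ℚₚ.≤-reflexive (sym (ℚₚ.0≤p⇒∣p∣≡p 0≤p))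
  ... | inj₂ p≤0 = ℚₚ.≤-trans p≤0 (ℚₚ.0≤∣p∣ p)

  -p≤∣p∣ : ∀ p → - p ≤ ∣ p ∣
  -p≤∣p∣ p = subst (- p ≤_) (ℚₚ.∣-p∣≡∣p∣ p) (p≤∣p∣ (- p))

  ^-distribˡ-+-* : ∀ p m n → p ^ℚ (m ℕ.+ n) ≡ (p ^ℚ m) * (p ^ℚ n)
  ^-distribˡ-+-* p zero    n = sym (ℚₚ.*-identityˡ _)
  ^-distribˡ-+-* p (suc m) n = trans (cong (p *_) (^-distribˡ-+-* p m n)) (sym (ℚₚ.*-assoc p _ _))

  ^-distribʳ-* : ∀ p q n → (p * q) ^ℚ n ≡ (p ^ℚ n) * (q ^ℚ n)
  ^-distribʳ-* p q zero    = refl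
  ^-distribʳ-* p q (suc n) = trans (cong ((p * q) *_) (^-distribʳ-* p q n)) (interchange p q (p ^ℚ n) (q ^ℚ n))
    where
    interchange : ∀ a b c d → (a * b) * (c * d) ≡ (a * c) * (b * d)
    interchange = solve-∀ ℚ-ring

  ^-nonNeg : ∀ {p} n → 0ℚ ≤ p → 0ℚ ≤ p ^ℚ n
  ^-nonNeg zero    _   = 0≤1
  ^-nonNeg (suc n) 0≤p = *-nonNeg 0≤p (^-nonNeg n 0≤p)

  ^-pos : ∀ {p} n → 0ℚ < p → 0ℚ < p ^ℚ n
  ^-pos zero    _   = 0<1
  ^-pos (suc n) 0<p = *-pos 0<p (^-pos n 0<p)

  ^-monoˡ-≤ : ∀ {p q} n → 0ℚ ≤ p → p ≤ q → p ^ℚ n ≤ q ^ℚ n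
  ^-monoˡ-≤ zero    _   _   = ℚₚ.≤-refl
  ^-monoˡ-≤ (suc n) 0≤p p≤q = *-mono-≤-0≤ 0≤p (^-nonNeg n 0≤p) p≤q (^-monoˡ-≤ n 0≤p p≤q)

  ^-≤1 : ∀ {p} n → 0ℚ ≤ p → p ≤ 1ℚ → p ^ℚ n ≤ 1ℚ
  ^-≤1 zero    _   _   = ℚₚ.≤-refl
  ^-≤1 (suc n) 0≤p p≤1 = ℚₚ.≤-trans (*-mono-≤-0≤ 0≤p (^-nonNeg n 0≤p) p≤1 (^-≤1 n 0≤p p≤1)) (ℚₚ.≤-reflexive (ℚₚ.*-identityˡ 1ℚ))

  ^-inverse : ∀ {p q} n → p * q ≡ 1ℚ → (p ^ℚ n) * (q ^ℚ n) ≡ 1ℚ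
  ^-inverse {p} {q} n pq≡1 = trans (sym (^-distribʳ-* p q n)) (trans (cong (_^ℚ n) pq≡1) (1^n≡1 n))
    where
    1^n≡1 : ∀ n → 1ℚ ^ℚ n ≡ 1ℚ
    1^n≡1 zero    = refl
    1^n≡1 (suc n) = trans (ℚₚ.*-identityˡ _) (1^n≡1 n)

  fromℕ-^ : ∀ m n → fromℕ (m ℕ.^ n) ≡ fromℕ m ^ℚ n
  fromℕ-^ m zero    = refl
  fromℕ-^ m (suc n) = trans (fromℕ-* m (m ℕ.^ n)) (cong (fromℕ m *_) (fromℕ-^ m n))

  sumℚ : (ℕ → ℚ) → ℕ → ℚ
  sumℚ f zero    = f 0
  sumℚ f (suc n) = sumℚ f n + f (suc n)

  sumℚ-cong : ∀ {f g} n → (∀ i → i ℕ.≤ n → f i ≡ g i) → sumℚ f n ≡ sumℚ g n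
  sumℚ-cong zero    f≡g = f≡g 0 z≤n
  sumℚ-cong (suc n) f≡g = cong₂ _+_ (sumℚ-cong n (λ i i≤n → f≡g i (ℕₚ.m≤n⇒m≤1+n i≤n))) (f≡g (suc n) ℕₚ.≤-refl)

  sumℚ-suc : ∀ f n → sumℚ f (suc n) ≡ f 0 + sumℚ (λ i → f (suc i)) n
  sumℚ-suc f zero    = refl
  sumℚ-suc f (suc n) = trans (cong (_+ f (suc (suc n))) (sumℚ-suc f n)) (ℚₚ.+-assoc (f 0) _ (f (suc (suc n))))

  sumℚ-+ : ∀ f g n → sumℚ (λ i → f i + g i) n ≡ sumℚ f n + sumℚ g n
  sumℚ-+ f g zero    = refl
  sumℚ-+ f g (suc n) = trans (cong (_+ (f (suc n) + g (suc n))) (sumℚ-+ f g n)) (interchange (sumℚ f n) (sumℚ g n) _ _)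
    where
    interchange : ∀ a b c d → (a + b) + (c + d) ≡ (a + c) + (b + d)
    interchange = solve-∀ ℚ-ring

  sumℚ-*ˡ : ∀ c f n → c * sumℚ f n ≡ sumℚ (λ i → c * f i) n
  sumℚ-*ˡ c f zero    = refl
  sumℚ-*ˡ c f (suc n) = trans (ℚₚ.*-distribˡ-+ c _ _) (cong (_+ c * f (suc n)) (sumℚ-*ˡ c f n))

  sumℚ-*ʳ : ∀ f n c → sumℚ f n * c ≡ sumℚ (λ i → f i * c) n
  sumℚ-*ʳ f n c = trans (ℚₚ.*-comm (sumℚ f n) c) (trans (sumℚ-*ˡ c f n) (sumℚ-cong n (λ i _ → ℚₚ.*-comm c (f i))))

  sumℚ-neg : ∀ f n → - sumℚ f n ≡ sumℚ (λ i → - f i) n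
  sumℚ-neg f zero    = refl
  sumℚ-neg f (suc n) = trans (ℚₚ.neg-distrib-+ (sumℚ f n) (f (suc n))) (cong (_+ - f (suc n)) (sumℚ-neg f n))

  sumℚ-0 : ∀ n → sumℚ (λ _ → 0ℚ) n ≡ 0ℚ
  sumℚ-0 zero    = refl
  sumℚ-0 (suc n) = trans (ℚₚ.+-identityʳ _) (sumℚ-0 n)

  sumℚ-reverse : ∀ f n → sumℚ f n ≡ sumℚ (λ i → f (n ℕ.∸ i)) n
  sumℚ-reverse f zero    = refl
  sumℚ-reverse f (suc n) = begin
    sumℚ f (suc n)                               ≡⟨ sumℚ-suc f n ⟩
    f 0 + sumℚ (λ i → f (suc i)) n               ≡⟨ cong (_+_ (f 0)) (sumℚ-reverse (λ i → f (suc i)) n) ⟩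
    f 0 + sumℚ (λ i → f (suc (n ℕ.∸ i))) n       ≡⟨ ℚₚ.+-comm (f 0) _ ⟩
    sumℚ (λ i → f (suc (n ℕ.∸ i))) n + f 0       ≡⟨ cong₂ _+_ (sumℚ-cong n (λ i i≤n → cong f (sym (ℕₚ.+-∸-assoc 1 i≤n))))
                                                            (cong f (sym (ℕₚ.n∸n≡0 n))) ⟩
    sumℚ (λ i → f (suc n ℕ.∸ i)) (suc n)         ∎
    where open ≡-Reasoning

  sumℚ-mono-≤ : ∀ {f g} n → (∀ i → i ℕ.≤ n → f i ≤ g i) → sumℚ f n ≤ sumℚ g n
  sumℚ-mono-≤ zero    f≤g = f≤g 0 z≤n
  sumℚ-mono-≤ (suc n) f≤g = ℚₚ.+-mono-≤ (sumℚ-mono-≤ n (λ i i≤n → f≤g i (ℕₚ.m≤n⇒m≤1+n i≤n))) (f≤g (suc n) ℕₚ.≤-refl)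

  sumℚ-nonNeg : ∀ {f} n → (∀ i → i ℕ.≤ n → 0ℚ ≤ f i) → 0ℚ ≤ sumℚ f n
  sumℚ-nonNeg n 0≤f = ℚₚ.≤-trans (ℚₚ.≤-reflexive (sym (sumℚ-0 n))) (sumℚ-mono-≤ n 0≤f)

  ∣sumℚ∣≤ : ∀ f n → ∣ sumℚ f n ∣ ≤ sumℚ (λ i → ∣ f i ∣) n
  ∣sumℚ∣≤ f zero    = ℚₚ.≤-refl
  ∣sumℚ∣≤ f (suc n) = ℚₚ.≤-trans (ℚₚ.∣p+q∣≤∣p∣+∣q∣ (sumℚ f n) (f (suc n))) (ℚₚ.+-monoˡ-≤ _ (∣sumℚ∣≤ f n))

  fromℤ-sumTo : ∀ f n → fromℤ (sumTo f n) ≡ sumℚ (λ i → fromℤ (f i)) n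
  fromℤ-sumTo f zero    = refl
  fromℤ-sumTo f (suc n) = trans (fromℤ-+ (sumTo f n) (f (suc n))) (cong (_+ fromℤ (f (suc n))) (fromℤ-sumTo f n))

  1/suc : ℕ → ℚ
  1/suc k = mkℚ (+ 1) k (1-coprimeTo _)

  1/suc-inverse : ∀ k → 1/suc k * fromℕ (suc k) ≡ 1ℚ
  1/suc-inverse k = ℚₚ.*-inverseˡ (fromℕ (suc k))

  1/suc-pos : ∀ k → 0ℚ < 1/suc k
  1/suc-pos k = ℚ.*<* (ℤ.+<+ (s≤s z≤n))

  invℕ-suc : ∀ k → invℕ (suc k) ≡ 1/suc k
  invℕ-suc k = ℚₚ.↥p/↧p≡p (1/suc k)

  invℕ-inverse : ∀ {X} → 1 ℕ.≤ X → invℕ X * fromℕ X ≡ 1ℚ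
  invℕ-inverse {suc k} _ = trans (cong (_* fromℕ (suc k)) (invℕ-suc k)) (1/suc-inverse k)

  invℕ-pos : ∀ {X} → 1 ℕ.≤ X → 0ℚ < invℕ X
  invℕ-pos {suc k} _ = subst (0ℚ <_) (sym (invℕ-suc k)) (1/suc-pos k)

  invℕ≤1 : ∀ X → invℕ X ≤ 1ℚ
  invℕ≤1 zero    = 0≤1
  invℕ≤1 (suc k) = subst (_≤ 1ℚ) (sym (invℕ-suc k)) (ℚ.*≤* (ℤ.+≤+ (s≤s z≤n)))

  private
    n≤2^n : ∀ n → n ℕ.≤ 2 ℕ.^ n
    n≤2^n zero    = z≤n
    n≤2^n (suc n) = ℕₚ.≤-trans (ℕₚ.+-mono-≤ (ℕₚ.m^n>0 2 n) (n≤2^n n)) (ℕₚ.≤-reflexive (cong (2 ℕ.^ n ℕ.+_) (sym (ℕₚ.+-identityʳ _))))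

    ≤fromℕ : ∀ p → ∃ λ N → p ≤ fromℕ N
    ≤fromℕ (mkℚ i d _) = ℤ.∣ i ∣ , ℚ.*≤* (ℤₚ.≤-trans (ℤₚ.≤-reflexive (ℤₚ.*-identityʳ i))
                                          (ℤₚ.≤-trans (i≤∣i∣ i) (ℤₚ.≤-trans (ℤₚ.≤-reflexive (sym (ℤₚ.*-identityʳ (+ ℤ.∣ i ∣))))
                                                                       (ℤₚ.*-monoˡ-≤-nonNeg (+ ℤ.∣ i ∣) (ℤ.+≤+ (s≤s z≤n))))))
      where
      i≤∣i∣ : ∀ i → i ℤ.≤ + ℤ.∣ i ∣
      i≤∣i∣ (+ _)      = ℤₚ.≤-refl
      i≤∣i∣ -[1+ _ ]   = ℤ.-≤+

    1/suc≤ : ∀ {ε} → 0ℚ < ε → ∃ λ d → 1/suc d ≤ ε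
    1/suc≤ {mkℚ (+ zero) d _}  (ℚ.*<* (ℤ.+<+ ()))
    1/suc≤ {mkℚ (+ suc p) d _} _ = d , ℚ.*≤* (ℤ.+≤+ (ℕₚ.*-monoˡ-≤ (suc d) (s≤s (z≤n {p}))))

  2^*½^≡1 : ∀ M → (fromℕ 2 ^ℚ M) * (½ ^ℚ M) ≡ 1ℚ
  2^*½^≡1 M = ^-inverse M refl

  archimedean-½ : ∀ c {ε} → 0ℚ < ε → ∀ M₀ → ∃ λ M → M₀ ℕ.≤ M × c * (½ ^ℚ M) ≤ ε
  archimedean-½ c {ε} 0<ε M₀ with ≤fromℕ c | 1/suc≤ 0<ε
  ... | N , c≤N | d , 1/d≤ε = M , ℕₚ.m≤m+n M₀ _ , (begin
    c * ½ᴹ                                    ≤⟨ *-monoʳ-≤-0≤ ½ᴹ ½ᴹ-nonNeg c≤N ⟩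
    fromℕ N * ½ᴹ                              ≡⟨ insert-inverse (fromℕ N) ½ᴹ (1/suc d) (fromℕ (suc d)) (1/suc-inverse d) ⟩
    fromℕ N * fromℕ (suc d) * ½ᴹ * 1/suc d    ≡⟨ cong (λ z → z * ½ᴹ * 1/suc d) (sym (fromℕ-* N (suc d))) ⟩
    fromℕ (N ℕ.* suc d) * ½ᴹ * 1/suc d        ≤⟨ *-monoʳ-≤-0≤ (1/suc d) (ℚₚ.<⇒≤ (1/suc-pos d)) (*-monoʳ-≤-0≤ ½ᴹ ½ᴹ-nonNeg (fromℕ-mono-≤ Nd≤2^M)) ⟩
    fromℕ (2 ℕ.^ M) * ½ᴹ * 1/suc d            ≡⟨ cong (λ z → z * ½ᴹ * 1/suc d) (fromℕ-^ 2 M) ⟩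
    (fromℕ 2 ^ℚ M) * ½ᴹ * 1/suc d             ≡⟨ cong (_* 1/suc d) (2^*½^≡1 M) ⟩
    1ℚ * 1/suc d                              ≡⟨ ℚₚ.*-identityˡ (1/suc d) ⟩
    1/suc d                                   ≤⟨ 1/d≤ε ⟩
    ε                                         ∎)
    where
    open ℚₚ.≤-Reasoning
    M = M₀ ℕ.+ N ℕ.* suc d
    ½ᴹ = ½ ^ℚ M
    ½ᴹ-nonNeg : 0ℚ ≤ ½ᴹ
    ½ᴹ-nonNeg = ^-nonNeg M (ℚₚ.<⇒≤ (1/suc-pos 1))
    Nd≤2^M : N ℕ.* suc d ℕ.≤ 2 ℕ.^ M
    Nd≤2^M = ℕₚ.≤-trans (ℕₚ.m≤n+m _ M₀) (n≤2^n M)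
    insert-inverse : ∀ a p i s → i * s ≡ 1ℚ → a * p ≡ a * s * p * i
    insert-inverse a p i s is≡1 = trans (sym (ℚₚ.*-identityʳ (a * p))) (trans (cong (a * p *_) (sym is≡1)) (reorder a p i s))
      where
      reorder : ∀ a p i s → a * p * (i * s) ≡ a * s * p * i
      reorder = solve-∀ ℚ-ring

  eval : List ℤ → ℚ → ℚ
  eval []      y = 0ℚ
  eval (a ∷ p) y = fromℤ a + y * eval p y

  evalℚ-polySub : ∀ P Q y → evalℚ P y - evalℚ Q y ≡ eval (polySub P Q) y
  evalℚ-polySub []      []      y = refl
  evalℚ-polySub []      (b ∷ Q) y = trans
    (cong (λ z → 0ℚ - (z + y * evalℚ Q y)) (fromℕℚ≡fromℕ b))
    (trans (distrib (fromℕ b) y (evalℚ Q y))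
           (cong₂ (λ u v → u + y * v) (sym (trans (cong fromℤ (ℤₚ.+-identityˡ (ℤ.- + b))) (fromℤ-neg (+ b))))
                                      (evalℚ-polySub [] Q y)))
    where
    distrib : ∀ b y e → 0ℚ - (b + y * e) ≡ - b + y * (0ℚ - e)
    distrib = solve-∀ ℚ-ring
  evalℚ-polySub (a ∷ P) []      y = trans
    (cong (λ z → (z + y * evalℚ P y) - 0ℚ) (fromℕℚ≡fromℕ a))
    (trans (distrib (fromℕ a) y (evalℚ P y)) (cong (λ v → fromℕ a + y * v) (evalℚ-polySub P [] y)))
    where
    distrib : ∀ a y e → (a + y * e) - 0ℚ ≡ a + y * (e - 0ℚ)
    distrib = solve-∀ ℚ-ring
  evalℚ-polySub (a ∷ P) (b ∷ Q) y = trans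
    (cong₂ (λ u v → (u + y * evalℚ P y) - (v + y * evalℚ Q y)) (fromℕℚ≡fromℕ a) (fromℕℚ≡fromℕ b))
    (trans (distrib (fromℕ a) (fromℕ b) y (evalℚ P y) (evalℚ Q y))
           (cong₂ (λ u v → u + y * v) (sym (trans (fromℤ-+ (+ a) (ℤ.- + b)) (cong (_+_ (fromℕ a)) (fromℤ-neg (+ b)))))
                                      (evalℚ-polySub P Q y)))
    where
    distrib : ∀ a b y e f → (a + y * e) - (b + y * f) ≡ (a - b) + y * (e - f)
    distrib = solve-∀ ℚ-ring

  eval-0 : ∀ P → eval P 0ℚ ≡ fromℤ (coeffℤ P 0)
  eval-0 []      = refl
  eval-0 (a ∷ P) = trans (cong (_+_ (fromℤ a)) (ℚₚ.*-zeroˡ (eval P 0ℚ))) (ℚₚ.+-identityʳ (fromℤ a))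

  evalUpTo : List ℤ → ℚ → ℕ → ℚ
  evalUpTo P y r = sumℚ (λ j → fromℤ (coeffℤ P j) * (y ^ℚ j)) r

  evalUpTo-∷ : ∀ a P y r → evalUpTo (a ∷ P) y (suc r) ≡ fromℤ a + y * evalUpTo P y r
  evalUpTo-∷ a P y r = begin
    evalUpTo (a ∷ P) y (suc r)                                      ≡⟨ sumℚ-suc _ r ⟩
    fromℤ a * 1ℚ + sumℚ (λ j → fromℤ (coeffℤ P j) * (y * (y ^ℚ j))) r ≡⟨ cong₂ _+_ (ℚₚ.*-identityʳ (fromℤ a))
                                                                          (sumℚ-cong r (λ j _ → swap (fromℤ (coeffℤ P j)) y (y ^ℚ j))) ⟩
    fromℤ a + sumℚ (λ j → y * (fromℤ (coeffℤ P j) * (y ^ℚ j))) r     ≡⟨ cong (_+_ (fromℤ a)) (sym (sumℚ-*ˡ y _ r)) ⟩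
    fromℤ a + y * evalUpTo P y r                                     ∎
    where
    open ≡-Reasoning
    swap : ∀ c y p → c * (y * p) ≡ y * (c * p)
    swap = solve-∀ ℚ-ring

  eval-split : ∀ r P y → eval P y ≡ evalUpTo P y r + (y ^ℚ suc r) * eval (drop (suc r) P) y
  eval-split zero    []      y = pad y
    where
    pad : ∀ y → 0ℚ ≡ 0ℚ * 1ℚ + y * 1ℚ * 0ℚ
    pad = solve-∀ ℚ-ring
  eval-split zero    (a ∷ P) y = unit (fromℤ a) y (eval P y)
    where
    unit : ∀ a y e → a + y * e ≡ a * 1ℚ + y * 1ℚ * e
    unit = solve-∀ ℚ-ring
  eval-split (suc r) []      y = sym (trans (cong (_+ (y ^ℚ suc (suc r)) * 0ℚ) evalUpTo-[]) (zero-right (y ^ℚ suc (suc r))))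
    where
    zero-right : ∀ z → 0ℚ + z * 0ℚ ≡ 0ℚ
    zero-right = solve-∀ ℚ-ring
    evalUpTo-[] : evalUpTo [] y (suc r) ≡ 0ℚ
    evalUpTo-[] = trans (sumℚ-cong (suc r) (λ i _ → ℚₚ.*-zeroˡ (y ^ℚ i))) (sumℚ-0 (suc r))
  eval-split (suc r) (a ∷ P) y = begin
    fromℤ a + y * eval P y                                                     ≡⟨ cong (λ z → fromℤ a + y * z) (eval-split r P y) ⟩
    fromℤ a + y * (evalUpTo P y r + (y ^ℚ suc r) * eval (drop (suc r) P) y)   ≡⟨ distrib (fromℤ a) y (evalUpTo P y r) _ _ ⟩
    (fromℤ a + y * evalUpTo P y r) + y * (y ^ℚ suc r) * eval (drop (suc r) P) y ≡⟨ cong (_+ _) (sym (evalUpTo-∷ a P y r)) ⟩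
    evalUpTo (a ∷ P) y (suc r) + (y ^ℚ suc (suc r)) * eval (drop (suc (suc r)) (a ∷ P)) y ∎
    where
    open ≡-Reasoning
    distrib : ∀ a y c p e → a + y * (c + p * e) ≡ (a + y * c) + y * p * e
    distrib = solve-∀ ℚ-ring

  drop-all : ∀ {A : Set} (xs : List A) n → length xs ℕ.≤ n → drop n xs ≡ []
  drop-all []       zero    _         = refl
  drop-all []       (suc n) _         = refl
  drop-all (x ∷ xs) (suc n) (s≤s len) = drop-all xs n len

  eval≡evalUpTo : ∀ M P y → length P ℕ.≤ suc M → eval P y ≡ evalUpTo P y M
  eval≡evalUpTo M P y len≤ = trans (eval-split M P y)
    (trans (cong (λ Q → evalUpTo P y M + (y ^ℚ suc M) * eval Q y) (drop-all P (suc M) len≤))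
           (trans (cong (_+_ (evalUpTo P y M)) (ℚₚ.*-zeroʳ (y ^ℚ suc M))) (ℚₚ.+-identityʳ (evalUpTo P y M))))

  norm₁ : List ℤ → ℚ
  norm₁ []      = 0ℚ
  norm₁ (a ∷ P) = ∣ fromℤ a ∣ + norm₁ P

  norm₁-nonNeg : ∀ P → 0ℚ ≤ norm₁ P
  norm₁-nonNeg []      = ℚₚ.≤-refl
  norm₁-nonNeg (a ∷ P) = +-nonNeg (ℚₚ.0≤∣p∣ (fromℤ a)) (norm₁-nonNeg P)

  norm₁-drop : ∀ k P → norm₁ (drop k P) ≤ norm₁ P
  norm₁-drop zero    P       = ℚₚ.≤-refl
  norm₁-drop (suc k) []      = ℚₚ.≤-refl
  norm₁-drop (suc k) (a ∷ P) = ℚₚ.≤-trans (norm₁-drop k P)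
    (subst (_≤ ∣ fromℤ a ∣ + norm₁ P) (ℚₚ.+-identityˡ (norm₁ P)) (ℚₚ.+-monoˡ-≤ (norm₁ P) (ℚₚ.0≤∣p∣ (fromℤ a))))

  ∣y*e∣≤ : ∀ {y e c} → ∣ y ∣ ≤ 1ℚ → ∣ e ∣ ≤ c → ∣ y * e ∣ ≤ c
  ∣y*e∣≤ {y} {e} {c} ∣y∣≤1 ∣e∣≤c = subst₂ _≤_ (sym (ℚₚ.∣p*q∣≡∣p∣*∣q∣ y e)) (ℚₚ.*-identityˡ c)
    (*-mono-≤-0≤ (ℚₚ.0≤∣p∣ y) (ℚₚ.0≤∣p∣ e) ∣y∣≤1 ∣e∣≤c)

  ∣eval∣≤norm₁ : ∀ P {y} → ∣ y ∣ ≤ 1ℚ → ∣ eval P y ∣ ≤ norm₁ P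
  ∣eval∣≤norm₁ []      _     = ℚₚ.≤-refl
  ∣eval∣≤norm₁ (a ∷ P) {y} ∣y∣≤1 = ℚₚ.≤-trans (ℚₚ.∣p+q∣≤∣p∣+∣q∣ (fromℤ a) (y * eval P y))
    (ℚₚ.+-monoʳ-≤ ∣ fromℤ a ∣ (∣y*e∣≤ ∣y∣≤1 (∣eval∣≤norm₁ P ∣y∣≤1)))

  lipschitz : List ℤ → ℚ
  lipschitz []      = 0ℚ
  lipschitz (a ∷ P) = lipschitz P + norm₁ P

  lipschitz-nonNeg : ∀ P → 0ℚ ≤ lipschitz P
  lipschitz-nonNeg []      = ℚₚ.≤-refl
  lipschitz-nonNeg (a ∷ P) = +-nonNeg (lipschitz-nonNeg P) (norm₁-nonNeg P)

  eval-lipschitz : ∀ P {y z} → ∣ y ∣ ≤ 1ℚ → ∣ z ∣ ≤ 1ℚ → ∣ eval P y - eval P z ∣ ≤ lipschitz P * ∣ y - z ∣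
  eval-lipschitz []      {y} {z} _ _ = ℚₚ.≤-reflexive (sym (ℚₚ.*-zeroˡ ∣ y - z ∣))
  eval-lipschitz (a ∷ P) {y} {z} ∣y∣≤1 ∣z∣≤1 = begin
    ∣ (fromℤ a + y * eval P y) - (fromℤ a + z * eval P z) ∣     ≡⟨ cong ∣_∣ (regroup (fromℤ a) y z (eval P y) (eval P z)) ⟩
    ∣ y * (eval P y - eval P z) + (y - z) * eval P z ∣         ≤⟨ ℚₚ.∣p+q∣≤∣p∣+∣q∣ (y * (eval P y - eval P z)) ((y - z) * eval P z) ⟩
    ∣ y * (eval P y - eval P z) ∣ + ∣ (y - z) * eval P z ∣     ≤⟨ ℚₚ.+-mono-≤ (∣y*e∣≤ ∣y∣≤1 (eval-lipschitz P ∣y∣≤1 ∣z∣≤1))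
                                                                            (ℚₚ.≤-reflexive (ℚₚ.∣p*q∣≡∣p∣*∣q∣ (y - z) (eval P z))) ⟩
    lipschitz P * ∣ y - z ∣ + ∣ y - z ∣ * ∣ eval P z ∣
      ≤⟨ ℚₚ.+-monoʳ-≤ (lipschitz P * ∣ y - z ∣) (*-monoˡ-≤-0≤ ∣ y - z ∣ (ℚₚ.0≤∣p∣ (y - z)) (∣eval∣≤norm₁ P ∣z∣≤1)) ⟩
    lipschitz P * ∣ y - z ∣ + ∣ y - z ∣ * norm₁ P              ≡⟨ factor (lipschitz P) ∣ y - z ∣ (norm₁ P) ⟩
    (lipschitz P + norm₁ P) * ∣ y - z ∣                        ∎
    where
    open ℚₚ.≤-Reasoning
    regroup : ∀ a y z e f → (a + y * e) - (a + z * f) ≡ y * (e - f) + (y - z) * f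
    regroup = solve-∀ ℚ-ring
    factor : ∀ l d n → l * d + d * n ≡ (l + n) * d
    factor = solve-∀ ℚ-ring

  eval-+ₚ : ∀ p q y → eval (p +ₚ q) y ≡ eval p y + eval q y
  eval-+ₚ []      q       y = sym (ℚₚ.+-identityˡ (eval q y))
  eval-+ₚ (a ∷ p) []      y = sym (ℚₚ.+-identityʳ _)
  eval-+ₚ (a ∷ p) (b ∷ q) y = trans (cong₂ (λ u v → u + y * v) (fromℤ-+ a b) (eval-+ₚ p q y)) (regroup (fromℤ a) (fromℤ b) y (eval p y) (eval q y))
    where
    regroup : ∀ a b y p q → (a + b) + y * (p + q) ≡ (a + y * p) + (b + y * q)
    regroup = solve-∀ ℚ-ring

  eval-·ₚ : ∀ c p y → eval (c ·ₚ p) y ≡ fromℤ c * eval p y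
  eval-·ₚ c []      y = sym (ℚₚ.*-zeroʳ (fromℤ c))
  eval-·ₚ c (a ∷ p) y = trans (cong₂ (λ u v → u + y * v) (fromℤ-* c a) (eval-·ₚ c p y)) (factor (fromℤ c) (fromℤ a) y (eval p y))
    where
    factor : ∀ c a y p → c * a + y * (c * p) ≡ c * (a + y * p)
    factor = solve-∀ ℚ-ring

  eval-*ₚ : ∀ p q y → eval (p *ₚ q) y ≡ eval p y * eval q y
  eval-*ₚ []      q y = sym (ℚₚ.*-zeroˡ (eval q y))
  eval-*ₚ (a ∷ p) q y = begin
    eval (a ·ₚ q +ₚ (+ 0 ∷ p *ₚ q)) y                     ≡⟨ eval-+ₚ (a ·ₚ q) (+ 0 ∷ p *ₚ q) y ⟩
    eval (a ·ₚ q) y + (0ℚ + y * eval (p *ₚ q) y)          ≡⟨ cong₂ (λ u v → u + (0ℚ + y * v)) (eval-·ₚ a q y) (eval-*ₚ p q y) ⟩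
    fromℤ a * eval q y + (0ℚ + y * (eval p y * eval q y)) ≡⟨ factor (fromℤ a) (eval q y) y (eval p y) ⟩
    (fromℤ a + y * eval p y) * eval q y                    ∎
    where
    open ≡-Reasoning
    factor : ∀ a q y p → a * q + (0ℚ + y * (p * q)) ≡ (a + y * p) * q
    factor = solve-∀ ℚ-ring

  eval-fromℤ : ∀ p k → eval p (fromℤ k) ≡ fromℤ (evalℤ p k)
  eval-fromℤ []      k = refl
  eval-fromℤ (a ∷ p) k = trans (cong (λ z → fromℤ a + fromℤ k * z) (eval-fromℤ p k))
    (sym (trans (fromℤ-+ a (k ℤ.* evalℤ p k)) (cong (_+_ (fromℤ a)) (fromℤ-* k (evalℤ p k)))))

  eval≡0⇒coeff≡0 : ∀ p → (∀ y → eval p y ≡ 0ℚ) → ∀ n → coeffℤ p n ≡ + 0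
  eval≡0⇒coeff≡0 p p≡0 = evalℤ≡0⇒coeff≡0 p (λ k _ → fromℤ-injective (trans (sym (eval-fromℤ p k)) (p≡0 (fromℤ k))))

  private
    ∣p-q∣≤ε⇒q-ε≤p : ∀ {p q ε} → ∣ p - q ∣ ≤ ε → q - ε ≤ p
    ∣p-q∣≤ε⇒q-ε≤p {p} {q} {ε} ∣p-q∣≤ε = 0≤q-p⇒p≤q (subst (0ℚ ≤_) (rearrange p q ε) (p≤q⇒0≤q-p (ℚₚ.≤-trans (-p≤∣p∣ (p - q)) ∣p-q∣≤ε)))
      where
      rearrange : ∀ p q ε → ε - - (p - q) ≡ p - (q - ε)
      rearrange = solve-∀ ℚ-ring

    ∣p-q∣≤ε⇒p≤q+ε : ∀ {p q ε} → ∣ p - q ∣ ≤ ε → p ≤ q + ε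
    ∣p-q∣≤ε⇒p≤q+ε {p} {q} {ε} ∣p-q∣≤ε = 0≤q-p⇒p≤q (subst (0ℚ ≤_) (rearrange p q ε) (p≤q⇒0≤q-p (ℚₚ.≤-trans (p≤∣p∣ (p - q)) ∣p-q∣≤ε)))
      where
      rearrange : ∀ p q ε → ε - (p - q) ≡ q + ε - p
      rearrange = solve-∀ ℚ-ring

  squeeze : ∀ {D β} → 0ℚ < β →
            (∀ {ε} → 0ℚ < ε → ∃ λ s → 0ℚ ≤ s × fromℕ 3 * s ≤ fromℕ 2 * β × ∣ D - s ∣ ≤ ε) →
            0ℚ ≤ D × D < β
  squeeze {D} {β} 0<β approx = 0≤D (D ℚₚ.<? 0ℚ) , D<β
    where
    0≤D : Dec (D < 0ℚ) → 0ℚ ≤ D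
    0≤D (no  D≮0) = ℚₚ.≮⇒≥ D≮0
    0≤D (yes D<0) = ⊥-elim (ℚₚ.<-irrefl refl (ℚₚ.<-≤-trans D<½D (begin
      ½ * D                 ≡⟨ half-neg D ⟩
      0ℚ - ½ * - D          ≤⟨ ℚₚ.+-monoˡ-≤ (- (½ * - D)) 0≤s ⟩
      s - ½ * - D           ≤⟨ ∣p-q∣≤ε⇒q-ε≤p {D} {s} ∣D-s∣≤ε ⟩
      D                     ∎)))
      where
      open ℚₚ.≤-Reasoning
      0<ε : 0ℚ < ½ * - D
      0<ε = *-pos (1/suc-pos 1) (ℚₚ.neg-antimono-< D<0)
      s = proj₁ (approx 0<ε)
      0≤s = proj₁ (proj₂ (approx 0<ε))
      ∣D-s∣≤ε = proj₂ (proj₂ (proj₂ (approx 0<ε)))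
      half-neg : ∀ d → ½ * d ≡ 0ℚ - ½ * - d
      half-neg = solve-∀ ℚ-ring
      D<½D : D < ½ * D
      D<½D = 0<q-p⇒p<q (subst (0ℚ <_) (half-gap D) 0<ε)
        where
        half-gap : ∀ d → ½ * - d ≡ ½ * d - d
        half-gap = solve-∀ ℚ-ring
    D<β : D < β
    D<β = ℚₚ.*-cancelˡ-<-nonNeg (fromℕ 3) {{ℚ.nonNegative (fromℕ-nonNeg 3)}} (begin-strict
      fromℕ 3 * D                           ≤⟨ *-monoˡ-≤-0≤ (fromℕ 3) (fromℕ-nonNeg 3) (∣p-q∣≤ε⇒p≤q+ε {D} {s} ∣D-s∣≤ε) ⟩
      fromℕ 3 * (s + ¼ * β)                 ≡⟨ ℚₚ.*-distribˡ-+ (fromℕ 3) s (¼ * β) ⟩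
      fromℕ 3 * s + fromℕ 3 * (¼ * β)       ≤⟨ ℚₚ.+-monoˡ-≤ (fromℕ 3 * (¼ * β)) 3s≤2β ⟩
      fromℕ 2 * β + fromℕ 3 * (¼ * β)       <⟨ ℚₚ.+-monoʳ-< (fromℕ 2 * β) ¾β<β ⟩
      fromℕ 2 * β + β                       ≡⟨ trans (add-one (fromℕ 2) β) (cong (_* β) (sym (fromℕ-+ 2 1))) ⟩
      fromℕ 3 * β                           ∎)
      where
      open ℚₚ.≤-Reasoning
      ¼ = 1/suc 3
      add-one : ∀ a b → a * b + b ≡ (a + 1ℚ) * b
      add-one = solve-∀ ℚ-ring
      0<ε : 0ℚ < ¼ * β
      0<ε = *-pos (1/suc-pos 3) 0<β
      s = proj₁ (approx 0<ε)
      3s≤2β = proj₁ (proj₂ (proj₂ (approx 0<ε)))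
      ∣D-s∣≤ε = proj₂ (proj₂ (proj₂ (approx 0<ε)))
      3¼<1 : fromℕ 3 * ¼ < 1ℚ
      3¼<1 = ℚ.*<* (ℤ.+<+ (s≤s (s≤s (s≤s (s≤s z≤n)))))
      ¾β<β : fromℕ 3 * (¼ * β) < β
      ¾β<β = subst₂ _<_ (ℚₚ.*-assoc (fromℕ 3) ¼ β) (ℚₚ.*-identityˡ β) (ℚₚ.*-monoˡ-<-pos β {{ℚ.positive 0<β}} 3¼<1)

  -- Walk from 0 to x in steps so short that, by the Lipschitz bound, P cannot jump across the gap around 0.
  positive-throughout : ∀ P {x c Λ} → 0ℚ ≤ x → x ≤ 1ℚ → 0ℚ < c → 0ℚ < Λ →
                        (∀ y → 0ℚ ≤ y → y ≤ x → c ≤ ∣ eval P y ∣ * Λ) → 0ℚ ≤ eval P 0ℚ → 0ℚ < eval P x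
  positive-throughout P {x} {c} {Λ} 0≤x x≤1 0<c 0<Λ c≤∣P∣Λ 0≤P0 =
    ℚₚ.*-cancelʳ-<-nonNeg Λ {{ℚ.nonNegative (ℚₚ.<⇒≤ 0<Λ)}}
      (subst (_< eval P x * Λ) (sym (ℚₚ.*-zeroˡ Λ)) (ℚₚ.<-≤-trans 0<c (subst (λ y → c ≤ eval P y * Λ) y[S]≡x (invariant S ℕₚ.≤-refl))))
    where
    fine = archimedean-½ (lipschitz P * Λ * x) 0<c 0
    M = proj₁ fine
    step = x * (½ ^ℚ M)
    0≤step : 0ℚ ≤ step
    0≤step = *-nonNeg 0≤x (^-nonNeg M (ℚₚ.<⇒≤ (1/suc-pos 1)))
    S = 2 ℕ.^ M
    y : ℕ → ℚ
    y j = fromℕ j * step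
    0≤y : ∀ j → 0ℚ ≤ y j
    0≤y j = *-nonNeg (fromℕ-nonNeg j) 0≤step
    y[S]≡x : y S ≡ x
    y[S]≡x = trans (cong (_* step) (fromℕ-^ 2 M)) (trans (swap (fromℕ 2 ^ℚ M) x (½ ^ℚ M)) (trans (cong (x *_) (2^*½^≡1 M)) (ℚₚ.*-identityʳ x)))
      where
      swap : ∀ a x b → a * (x * b) ≡ x * (a * b)
      swap = solve-∀ ℚ-ring
    y≤x : ∀ {j} → j ℕ.≤ S → y j ≤ x
    y≤x {j} j≤S = subst (y j ≤_) y[S]≡x (*-monoʳ-≤-0≤ step 0≤step (fromℕ-mono-≤ j≤S))
    ∣y∣≤1 : ∀ {j} → j ℕ.≤ S → ∣ y j ∣ ≤ 1ℚ
    ∣y∣≤1 {j} j≤S = subst (_≤ 1ℚ) (sym (ℚₚ.0≤p⇒∣p∣≡p (0≤y j))) (ℚₚ.≤-trans (y≤x j≤S) x≤1)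
    y[1+j]-y[j] : ∀ j → y (suc j) - y j ≡ step
    y[1+j]-y[j] j = trans (cong (λ z → z * step - y j) (fromℕ-+ 1 j)) (cancel (fromℕ j) step)
      where
      cancel : ∀ a s → (1ℚ + a) * s - a * s ≡ s
      cancel = solve-∀ ℚ-ring
    drop≤ : ∀ j → j ℕ.< S → eval P (y j) - eval P (y (suc j)) ≤ lipschitz P * step
    drop≤ j j<S = begin
      eval P (y j) - eval P (y (suc j))      ≤⟨ p≤∣p∣ _ ⟩
      ∣ eval P (y j) - eval P (y (suc j)) ∣  ≡⟨ trans (sym (ℚₚ.∣-p∣≡∣p∣ _)) (cong ∣_∣ (neg-minus (eval P (y j)) _)) ⟩
      ∣ eval P (y (suc j)) - eval P (y j) ∣  ≤⟨ eval-lipschitz P (∣y∣≤1 j<S) (∣y∣≤1 (ℕₚ.<⇒≤ j<S)) ⟩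
      lipschitz P * ∣ y (suc j) - y j ∣      ≡⟨ cong (λ z → lipschitz P * ∣ z ∣) (y[1+j]-y[j] j) ⟩
      lipschitz P * ∣ step ∣                 ≡⟨ cong (lipschitz P *_) (ℚₚ.0≤p⇒∣p∣≡p 0≤step) ⟩
      lipschitz P * step                     ∎
      where
      open ℚₚ.≤-Reasoning
      neg-minus : ∀ a b → - (a - b) ≡ b - a
      neg-minus = solve-∀ ℚ-ring
    invariant : ∀ j → j ℕ.≤ S → c ≤ eval P (y j) * Λ
    invariant zero    _     = subst (λ v → c ≤ v * Λ) (ℚₚ.0≤p⇒∣p∣≡p 0≤P[y0]) (c≤∣P∣Λ (y 0) (0≤y 0) (y≤x z≤n))
      where
      0≤P[y0] : 0ℚ ≤ eval P (y 0)
      0≤P[y0] = subst (λ z → 0ℚ ≤ eval P z) (sym (ℚₚ.*-zeroˡ step)) 0≤P0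
    invariant (suc j) 1+j≤S = subst (λ v → c ≤ v * Λ) (ℚₚ.0≤p⇒∣p∣≡p 0≤P[y]) (c≤∣P∣Λ (y (suc j)) (0≤y (suc j)) (y≤x 1+j≤S))
      where
      0≤P[y]Λ : 0ℚ ≤ eval P (y (suc j)) * Λ
      0≤P[y]Λ = begin
        0ℚ                                          ≡⟨ sym (ℚₚ.+-inverseʳ c) ⟩
        c - c                                       ≤⟨ ℚₚ.+-mono-≤ (invariant j (ℕₚ.<⇒≤ 1+j≤S)) (ℚₚ.neg-antimono-≤ small-step) ⟩
        eval P (y j) * Λ - lipschitz P * step * Λ   ≡⟨ factor (eval P (y j)) (lipschitz P * step) Λ ⟩
        (eval P (y j) - lipschitz P * step) * Λ     ≤⟨ *-monoʳ-≤-0≤ Λ (ℚₚ.<⇒≤ 0<Λ) one-step ⟩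
        eval P (y (suc j)) * Λ                      ∎
        where
        open ℚₚ.≤-Reasoning
        factor : ∀ a b L → a * L - b * L ≡ (a - b) * L
        factor = solve-∀ ℚ-ring
        one-step : eval P (y j) - lipschitz P * step ≤ eval P (y (suc j))
        one-step = 0≤q-p⇒p≤q (subst (0ℚ ≤_) (rearrange (eval P (y j)) (eval P (y (suc j))) _) (p≤q⇒0≤q-p (drop≤ j 1+j≤S)))
          where
          rearrange : ∀ a b l → l - (a - b) ≡ b - (a - l)
          rearrange = solve-∀ ℚ-ring
        small-step : lipschitz P * step * Λ ≤ c
        small-step = subst (_≤ c) (reorder (lipschitz P) Λ x (½ ^ℚ M)) (proj₂ (proj₂ fine))
          where
          reorder : ∀ l L x h → l * L * x * h ≡ l * (x * h) * L
          reorder = solve-∀ ℚ-ring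
      0≤P[y] : 0ℚ ≤ eval P (y (suc j))
      0≤P[y] = ℚₚ.*-cancelʳ-≤-pos Λ {{ℚ.positive 0<Λ}} (subst (_≤ eval P (y (suc j)) * Λ) (sym (ℚₚ.*-zeroˡ Λ)) 0≤P[y]Λ)


module BezoutIdentity where
  open ℚ using (ℚ; 0ℚ; 1ℚ; _+_; _*_; _-_; -_)
  open IntegerPolynomials
  open RationalPolynomials

  record DegPoly : Set where
    constructor degPoly
    field
      deg          : ℕ
      lower        : List ℤ
      lower-length : length lower ≡ deg
      lead         : ℤ
      lead≢0       : lead ≢ + 0
  open DegPoly

  evalDeg : DegPoly → ℚ → ℚ
  evalDeg Q y = eval (lower Q) y + fromℤ (lead Q) * (y ^ℚ deg Q)

  toList : DegPoly → List ℤ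
  toList Q = lower Q ++ lead Q ∷ []

  private
    only-top : ∀ c y → c + y * 0ℚ ≡ 0ℚ + c * 1ℚ
    only-top = solve-∀ ℚ-ring
    add-top : ∀ a y e c p → a + y * (e + c * p) ≡ (a + y * e) + c * (y * p)
    add-top = solve-∀ ℚ-ring

  eval-snoc : ∀ xs c y → eval (xs ++ c ∷ []) y ≡ eval xs y + fromℤ c * (y ^ℚ length xs)
  eval-snoc []       c y = only-top (fromℤ c) y
  eval-snoc (a ∷ xs) c y = trans (cong (λ z → fromℤ a + y * z) (eval-snoc xs c y)) (add-top (fromℤ a) y (eval xs y) (fromℤ c) _)

  eval-toList : ∀ Q y → eval (toList Q) y ≡ evalDeg Q y
  eval-toList (degPoly d xs refl c _) y = eval-snoc xs c y

  nonConstant-toList : ∀ Q → 1 ℕ.≤ deg Q → NonConstant (toList Q)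
  nonConstant-toList (degPoly d xs refl c c≢0) 1≤d = d , 1≤d , subst (_≢ + 0) (sym (coeff-snoc xs)) c≢0
    where
    coeff-snoc : ∀ xs → coeffℤ (xs ++ c ∷ []) (length xs) ≡ c
    coeff-snoc []       = refl
    coeff-snoc (_ ∷ xs) = coeff-snoc xs

  split-last : ∀ d xs → length xs ≡ suc d →
               ∃ λ ys → ∃ λ r → length ys ≡ d × ∀ y → eval xs y ≡ eval ys y + fromℤ r * (y ^ℚ d)
  split-last zero    (r ∷ [])  refl = [] , r , refl , only-top (fromℤ r)
  split-last (suc d) (a ∷ xs)  len with split-last d xs (ℕₚ.suc-injective len)
  ... | ys , r , len′ , xs≡ = a ∷ ys , r , cong suc len′ ,
                               λ y → trans (cong (λ z → fromℤ a + y * z) (xs≡ y)) (add-top (fromℤ a) y (eval ys y) (fromℤ r) _)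

  zero-or-degPoly : ∀ d R → length R ≡ d →
                    (∀ y → eval R y ≡ 0ℚ) ⊎ ∃ λ Q → deg Q ℕ.< d × ∀ y → eval R y ≡ evalDeg Q y
  zero-or-degPoly zero    []  _   = inj₁ (λ _ → refl)
  zero-or-degPoly (suc d) R   len with split-last d R len
  ... | R′ , r , len′ , R≡ with r ℤ.≟ + 0
  ...   | no r≢0   = inj₂ (degPoly d R′ len′ r r≢0 , ℕₚ.≤-refl , R≡)
  ...   | yes refl = ⊎-map (λ R′≡0 y → trans (R≡ y) (trans (drop-top (eval R′ y) (y ^ℚ d)) (R′≡0 y)))
                           (λ { (Q , deg<d , R′≡Q) → Q , ℕₚ.m≤n⇒m≤1+n deg<d , λ y → trans (R≡ y) (trans (drop-top (eval R′ y) (y ^ℚ d)) (R′≡Q y)) })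
                           (zero-or-degPoly d R′ len′)
    where
    drop-top : ∀ e p → e + 0ℚ * p ≡ e
    drop-top = solve-∀ ℚ-ring

  private
    length-·ₚ : ∀ c p → length (c ·ₚ p) ≡ length p
    length-·ₚ c []      = refl
    length-·ₚ c (a ∷ p) = cong suc (length-·ₚ c p)

    length-+ₚ : ∀ p q → length p ≡ length q → length (p +ₚ q) ≡ length p
    length-+ₚ []      q       len = sym len
    length-+ₚ (a ∷ p) []      _   = refl
    length-+ₚ (a ∷ p) (b ∷ q) len = cong suc (length-+ₚ p q (ℕₚ.suc-injective len))

    zeros : ℕ → List ℤ
    zeros d = replicate d (+ 0)

    eval-zeros : ∀ d y → eval (zeros d) y ≡ 0ℚ
    eval-zeros zero    y = refl
    eval-zeros (suc d) y = trans (cong (λ z → 0ℚ + y * z) (eval-zeros d y)) (trans (ℚₚ.+-identityˡ _) (ℚₚ.*-zeroʳ y))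

    length-zeros : ∀ d → length (zeros d) ≡ d
    length-zeros zero    = refl
    length-zeros (suc d) = cong suc (length-zeros d)

  PseudoDivision : DegPoly → List ℤ → Set
  PseudoDivision Q P = ∃ λ α → ∃ λ S → ∃ λ R →
    α ≢ + 0 × length R ≡ deg Q × ∀ y → fromℤ α * eval P y ≡ eval S y * evalDeg Q y + eval R y

  -- Induction on P = a + y P′: from α P′ = S Q + R, the remainder α a + y R has one coefficient r too many,
  -- which is removed by subtracting r Q after multiplying through by lead Q.
  pseudo-divide : ∀ Q P → PseudoDivision Q P
  pseudo-divide Q [] = + 1 , [] , zeros (deg Q) , (λ ()) , length-zeros (deg Q) ,
                       λ y → trans (trivial (evalDeg Q y)) (cong (_+_ (0ℚ * evalDeg Q y)) (sym (eval-zeros (deg Q) y)))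
    where
    trivial : ∀ q → 1ℚ * 0ℚ ≡ 0ℚ * q + 0ℚ
    trivial = solve-∀ ℚ-ring
  pseudo-divide Q (a ∷ P) with pseudo-divide Q P
  ... | α , S , R , α≢0 , lenR , αP≡ with split-last (deg Q) (α ℤ.* a ∷ R) (cong suc lenR)
  ... | R′ , r , lenR′ , αaR≡ =
    c ℤ.* α , r ∷ c ·ₚ S , c ·ₚ R′ +ₚ ℤ.- r ·ₚ lower Q , *-≢0 (lead≢0 Q) α≢0 , length-remainder , identity
    where
    c = lead Q
    length-remainder : length (c ·ₚ R′ +ₚ ℤ.- r ·ₚ lower Q) ≡ deg Q
    length-remainder = trans
      (length-+ₚ (c ·ₚ R′) (ℤ.- r ·ₚ lower Q) (trans (length-·ₚ c R′) (trans lenR′ (sym (trans (length-·ₚ (ℤ.- r) (lower Q)) (lower-length Q))))))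
                             (trans (length-·ₚ c R′) lenR′)
    identity : ∀ y → fromℤ (c ℤ.* α) * eval (a ∷ P) y ≡ eval (r ∷ c ·ₚ S) y * evalDeg Q y + eval (c ·ₚ R′ +ₚ ℤ.- r ·ₚ lower Q) y
    identity y = begin
      fromℤ (c ℤ.* α) * (fromℤ a + y * eval P y)                                    ≡⟨ cong (_* _) (fromℤ-* c α) ⟩
      fromℤ c * fromℤ α * (fromℤ a + y * eval P y)                                  ≡⟨ distrib (fromℤ c) (fromℤ α) (fromℤ a) y (eval P y) ⟩
      fromℤ c * (fromℤ α * fromℤ a + y * (fromℤ α * eval P y))                      ≡⟨ cong₂ (λ u v → fromℤ c * (u + y * v)) (sym (fromℤ-* α a)) (αP≡ y) ⟩
      fromℤ c * (fromℤ (α ℤ.* a) + y * (eval S y * evalDeg Q y + eval R y))        ≡⟨ distrib′ (fromℤ c) (fromℤ (α ℤ.* a)) y (eval S y) (evalDeg Q y) (eval R y) ⟩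
      fromℤ c * y * eval S y * evalDeg Q y + fromℤ c * eval (α ℤ.* a ∷ R) y        ≡⟨ cong (λ z → fromℤ c * y * eval S y * evalDeg Q y + fromℤ c * z) (αaR≡ y) ⟩
      fromℤ c * y * eval S y * evalDeg Q y + fromℤ c * (eval R′ y + fromℤ r * (y ^ℚ deg Q))
        ≡⟨ cancel-top (fromℤ c) y (eval S y) (eval (lower Q) y) (y ^ℚ deg Q) (eval R′ y) (fromℤ r) ⟩
      (fromℤ r + y * (fromℤ c * eval S y)) * evalDeg Q y + (fromℤ c * eval R′ y + - fromℤ r * eval (lower Q) y)
        ≡⟨ cong₂ (λ u v → (fromℤ r + y * u) * evalDeg Q y + v) (sym (eval-·ₚ c S y)) (sym remainder≡) ⟩
      eval (r ∷ c ·ₚ S) y * evalDeg Q y + eval (c ·ₚ R′ +ₚ ℤ.- r ·ₚ lower Q) y     ∎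
      where
      open ≡-Reasoning
      distrib : ∀ c a x y p → c * a * (x + y * p) ≡ c * (a * x + y * (a * p))
      distrib = solve-∀ ℚ-ring
      distrib′ : ∀ c u y s q r → c * (u + y * (s * q + r)) ≡ c * y * s * q + c * (u + y * r)
      distrib′ = solve-∀ ℚ-ring
      cancel-top : ∀ c y s b p i r → c * y * s * (b + c * p) + c * (i + r * p) ≡ (r + y * (c * s)) * (b + c * p) + (c * i + - r * b)
      cancel-top = solve-∀ ℚ-ring
      remainder≡ : eval (c ·ₚ R′ +ₚ ℤ.- r ·ₚ lower Q) y ≡ fromℤ c * eval R′ y + - fromℤ r * eval (lower Q) y
      remainder≡ = trans (eval-+ₚ (c ·ₚ R′) (ℤ.- r ·ₚ lower Q) y) (cong₂ _+_ (eval-·ₚ c R′ y) (trans (eval-·ₚ (ℤ.- r) (lower Q) y) (cong (_* eval (lower Q) y) (fromℤ-neg r))))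

  record Bezout (A B : List ℤ) : Set where
    field
      U V      : List ℤ
      N        : ℤ
      N≢0      : N ≢ + 0
      identity : ∀ y → eval U y * eval A y + eval V y * eval B y ≡ fromℤ N

  record ScaledCommonFactor (A B : List ℤ) : Set where
    field
      G P Q    : List ℤ
      nonConst : NonConstant G
      α β      : ℤ
      α≢0      : α ≢ + 0
      β≢0      : β ≢ + 0
      GP≡αA    : ∀ y → eval G y * eval P y ≡ fromℤ α * eval A y
      GQ≡βB    : ∀ y → eval G y * eval Q y ≡ fromℤ β * eval B y

  module _ {α} (P S B R : List ℤ) (αP≡SB+R : ∀ y → fromℤ α * eval P y ≡ eval S y * eval B y + eval R y) where

    bezout-step : Bezout B R → Bezout P B
    bezout-step bz = record { U = α ·ₚ V ; V = U +ₚ ℤ.- + 1 ·ₚ (V *ₚ S) ; N = N ; N≢0 = N≢0 ; identity = identity′ }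
      where
      open Bezout bz
      identity′ : ∀ y → eval (α ·ₚ V) y * eval P y + eval (U +ₚ ℤ.- + 1 ·ₚ (V *ₚ S)) y * eval B y ≡ fromℤ N
      identity′ y = begin
        eval (α ·ₚ V) y * eval P y + eval (U +ₚ ℤ.- + 1 ·ₚ (V *ₚ S)) y * eval B y
          ≡⟨ cong₂ (λ u v → u * eval P y + v * eval B y) (eval-·ₚ α V y)
                   (trans (eval-+ₚ U _ y) (cong (_+_ (eval U y)) (trans (eval-·ₚ _ (V *ₚ S) y) (cong (- 1ℚ *_) (eval-*ₚ V S y))))) ⟩
        fromℤ α * eval V y * eval P y + (eval U y + - 1ℚ * (eval V y * eval S y)) * eval B y
          ≡⟨ regroup (fromℤ α) (eval V y) (eval P y) (eval U y) (eval S y) (eval B y) ⟩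
        eval U y * eval B y + eval V y * (fromℤ α * eval P y - eval S y * eval B y)
          ≡⟨ cong (λ z → eval U y * eval B y + eval V y * (z - eval S y * eval B y)) (αP≡SB+R y) ⟩
        eval U y * eval B y + eval V y * (eval S y * eval B y + eval R y - eval S y * eval B y)
          ≡⟨ cong (λ z → eval U y * eval B y + eval V y * z) (cancel (eval S y * eval B y) (eval R y)) ⟩
        eval U y * eval B y + eval V y * eval R y
          ≡⟨ identity y ⟩
        fromℤ N ∎
        where
        open ≡-Reasoning
        regroup : ∀ a v p u s q → a * v * p + (u + - 1ℚ * (v * s)) * q ≡ u * q + v * (a * p - s * q)
        regroup = solve-∀ ℚ-ring
        cancel : ∀ a r → a + r - a ≡ r
        cancel = solve-∀ ℚ-ring

    common-factor-step : α ≢ + 0 → ScaledCommonFactor B R → ScaledCommonFactor P B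
    common-factor-step α≢0 cf = record
      { G = G ; P = β ·ₚ (S *ₚ P′) +ₚ α′ ·ₚ Q′ ; Q = P′ ; nonConst = nonConst
      ; α = α′ ℤ.* β ℤ.* α ; β = α′ ; α≢0 = *-≢0 (*-≢0 α≢0′ β≢0) α≢0 ; β≢0 = α≢0′
      ; GP≡αA = identity′ ; GQ≡βB = GP≡αA }
      where
      open ScaledCommonFactor cf renaming (P to P′; Q to Q′; α to α′; α≢0 to α≢0′)
      identity′ : ∀ y → eval G y * eval (β ·ₚ (S *ₚ P′) +ₚ α′ ·ₚ Q′) y ≡ fromℤ (α′ ℤ.* β ℤ.* α) * eval P y
      identity′ y = begin
        eval G y * eval (β ·ₚ (S *ₚ P′) +ₚ α′ ·ₚ Q′) y
          ≡⟨ cong (eval G y *_) (trans (eval-+ₚ (β ·ₚ (S *ₚ P′)) (α′ ·ₚ Q′) y)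
                 (cong₂ _+_ (trans (eval-·ₚ β (S *ₚ P′) y) (cong (fromℤ β *_) (eval-*ₚ S P′ y))) (eval-·ₚ α′ Q′ y))) ⟩
        eval G y * (fromℤ β * (eval S y * eval P′ y) + fromℤ α′ * eval Q′ y)
          ≡⟨ distrib (eval G y) (fromℤ β) (eval S y) (eval P′ y) (fromℤ α′) (eval Q′ y) ⟩
        fromℤ β * eval S y * (eval G y * eval P′ y) + fromℤ α′ * (eval G y * eval Q′ y)
          ≡⟨ cong₂ (λ u v → fromℤ β * eval S y * u + fromℤ α′ * v) (GP≡αA y) (GQ≡βB y) ⟩
        fromℤ β * eval S y * (fromℤ α′ * eval B y) + fromℤ α′ * (fromℤ β * eval R y)
          ≡⟨ factor (fromℤ β) (eval S y) (fromℤ α′) (eval B y) (eval R y) ⟩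
        fromℤ α′ * fromℤ β * (eval S y * eval B y + eval R y)
          ≡⟨ cong₂ _*_ (sym (fromℤ-* α′ β)) (sym (αP≡SB+R y)) ⟩
        fromℤ (α′ ℤ.* β) * (fromℤ α * eval P y)
          ≡⟨ trans (sym (ℚₚ.*-assoc (fromℤ (α′ ℤ.* β)) (fromℤ α) (eval P y))) (cong (_* eval P y) (sym (fromℤ-* (α′ ℤ.* β) α))) ⟩
        fromℤ (α′ ℤ.* β ℤ.* α) * eval P y ∎
        where
        open ≡-Reasoning
        distrib : ∀ g b s p a r → g * (b * (s * p) + a * r) ≡ b * s * (g * p) + a * (g * r)
        distrib = solve-∀ ℚ-ring
        factor : ∀ b s a q r → b * s * (a * q) + a * (b * r) ≡ a * b * (s * q + r)
        factor = solve-∀ ℚ-ring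

  euclid : ∀ fuel (Q : DegPoly) → deg Q ℕ.< fuel → ∀ P {B} → (∀ y → eval B y ≡ evalDeg Q y) →
           Bezout P B ⊎ ScaledCommonFactor P B
  euclid (suc fuel) (degPoly zero [] refl c c≢0) _ P {B} B≡c =
    inj₁ (record { U = [] ; V = + 1 ∷ [] ; N = c ; N≢0 = c≢0
                 ; identity = λ y → trans (cong (λ b → 0ℚ * eval P y + (1ℚ + y * 0ℚ) * b) (B≡c y)) (constant (eval P y) y (fromℤ c)) })
    where
    constant : ∀ p y c → 0ℚ * p + (1ℚ + y * 0ℚ) * (0ℚ + c * 1ℚ) ≡ c
    constant = solve-∀ ℚ-ring
  euclid (suc fuel) Q@(degPoly (suc d) _ _ _ _) (s≤s deg<fuel) P {B} B≡Q
    with pseudo-divide Q P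
  ... | α , S , R , α≢0 , lenR , αP≡SQ+R with zero-or-degPoly (suc d) R lenR
  ...   | inj₁ R≡0 = inj₂ (record
          { G = toList Q ; P = S ; Q = + 1 ∷ [] ; nonConst = nonConstant-toList Q (s≤s z≤n)
          ; α = α ; β = + 1 ; α≢0 = α≢0 ; β≢0 = λ ()
          ; GP≡αA = QS≡αP ; GQ≡βB = Q≡B })
    where
    QS≡αP : ∀ y → eval (toList Q) y * eval S y ≡ fromℤ α * eval P y
    QS≡αP y = begin
      eval (toList Q) y * eval S y            ≡⟨ cong (_* eval S y) (eval-toList Q y) ⟩
      evalDeg Q y * eval S y                  ≡⟨ ℚₚ.*-comm (evalDeg Q y) (eval S y) ⟩
      eval S y * evalDeg Q y                  ≡⟨ sym (ℚₚ.+-identityʳ _) ⟩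
      eval S y * evalDeg Q y + 0ℚ             ≡⟨ cong (_+_ (eval S y * evalDeg Q y)) (sym (R≡0 y)) ⟩
      eval S y * evalDeg Q y + eval R y       ≡⟨ sym (αP≡SQ+R y) ⟩
      fromℤ α * eval P y                      ∎
      where open ≡-Reasoning
    Q≡B : ∀ y → eval (toList Q) y * eval (+ 1 ∷ []) y ≡ 1ℚ * eval B y
    Q≡B y = trans (cong (_* eval (+ 1 ∷ []) y) (trans (eval-toList Q y) (sym (B≡Q y)))) (unit (eval B y) y)
      where
      unit : ∀ b y → b * (1ℚ + y * 0ℚ) ≡ 1ℚ * b
      unit = solve-∀ ℚ-ring
  ...   | inj₂ (Q′ , deg<d , R≡Q′) =
          ⊎-map (bezout-step P S B R αP≡SB+R) (common-factor-step P S B R αP≡SB+R α≢0)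
                (euclid fuel Q′ (ℕₚ.<-≤-trans deg<d deg<fuel) B {R} R≡Q′)
    where
    αP≡SB+R : ∀ y → fromℤ α * eval P y ≡ eval S y * eval B y + eval R y
    αP≡SB+R y = trans (αP≡SQ+R y) (cong (λ z → eval S y * z + eval R y) (sym (B≡Q y)))

  scaled-divides : ∀ G P {α} A → (∀ y → eval G y * eval P y ≡ fromℤ α * eval A y) → G ∣[ α · A ]
  scaled-divides G P {α} A GP≡αA = cofactor P λ n → ℤₚ.i-j≡0⇒i≡j _ _ (begin
    mulCoeff G P n ℤ.- α ℤ.* coeffℤ A n          ≡⟨ cong₂ ℤ._+_ (sym (coeff-*ₚ G P n)) (trans (ℤₚ.neg-distribˡ-* α _) (sym (coeff-·ₚ (ℤ.- α) A n))) ⟩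
    coeffℤ (G *ₚ P) n ℤ.+ coeffℤ (ℤ.- α ·ₚ A) n  ≡⟨ sym (coeff-+ₚ (G *ₚ P) _ n) ⟩
    coeffℤ (G *ₚ P +ₚ ℤ.- α ·ₚ A) n              ≡⟨ eval≡0⇒coeff≡0 (G *ₚ P +ₚ ℤ.- α ·ₚ A) difference≡0 n ⟩
    + 0                                          ∎)
    where
    open ≡-Reasoning
    cancel : ∀ a e → a * e + - a * e ≡ 0ℚ
    cancel = solve-∀ ℚ-ring
    difference≡0 : ∀ y → eval (G *ₚ P +ₚ ℤ.- α ·ₚ A) y ≡ 0ℚ
    difference≡0 y = trans (eval-+ₚ (G *ₚ P) _ y)
      (trans (cong₂ _+_ (trans (eval-*ₚ G P y) (GP≡αA y)) (trans (eval-·ₚ (ℤ.- α) A y) (cong (_* eval A y) (fromℤ-neg α))))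
             (cancel (fromℤ α) (eval A y)))

  bezout : ∀ A B → + 0 ℤ.< coeffℤ B 0 → IrreducibleFraction A B → Bezout A B
  bezout A B 0<b₀ irreducible with zero-or-degPoly (length B) B refl
  ... | inj₁ B≡0 = ⊥-elim (ℤₚ.<-irrefl (sym (fromℤ-injective (trans (sym (eval-0 B)) (B≡0 0ℚ)))) 0<b₀)
  ... | inj₂ (B′ , _ , B≡B′) = [ id , no-common-factor ]′ (euclid (suc (deg B′)) B′ ℕₚ.≤-refl A B≡B′)
    where
    no-common-factor : ScaledCommonFactor A B → Bezout A B
    no-common-factor cf =
      let open ScaledCommonFactor cf
          (D , D-nonConst , D∣A , D∣B) = common-factor α≢0 β≢0 (commonFactor G nonConst (scaled-divides G P A GP≡αA) (scaled-divides G Q B GQ≡βB))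
      in ⊥-elim (irreducible D D-nonConst D∣A D∣B)

module DigitExtraction where
  open ℚ using (ℚ; mkℚ; 0ℚ; 1ℚ; ½; _+_; _*_; _-_; -_; _≤_; _<_; ∣_∣; _⊔_)
  open IntegerPolynomials using (1≤∣i∣)
  open RationalPolynomials
  open BezoutIdentity using (Bezout; bezout)

  partialSum : (ℕ → ℕ) → ℚ → ℕ → ℚ
  partialSum t y M = sumℚ (λ i → fromℕ (t i) * (y ^ℚ i)) M

  fromℕ-digitSum : ∀ t M → fromℕ (digitSum t M) ≡ sumℚ (λ i → fromℕ (t i)) M
  fromℕ-digitSum t zero    = refl
  fromℕ-digitSum t (suc M) = trans (fromℕ-+ (digitSum t M) (t (suc M))) (cong (_+ fromℕ (t (suc M))) (fromℕ-digitSum t M))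

  module Truncation {t : ℕ → ℕ} (A B : List ℤ) (gf : GFEquals t A B) where
    private
      tℚ : ℕ → ℚ
      tℚ i = fromℕ (t i)
      b : ℕ → ℚ
      b k = fromℤ (coeffℤ B k)

    convolution : ∀ n → sumℚ (λ i → tℚ i * b (n ℕ.∸ i)) n ≡ fromℤ (coeffℤ A n)
    convolution n = begin
      sumℚ (λ i → tℚ i * b (n ℕ.∸ i)) n                   ≡⟨ sumℚ-cong n (λ i i≤n → cong (λ k → tℚ k * b (n ℕ.∸ i)) (sym (ℕₚ.m∸[m∸n]≡n i≤n))) ⟩
      sumℚ (λ i → tℚ (n ℕ.∸ (n ℕ.∸ i)) * b (n ℕ.∸ i)) n   ≡⟨ sym (sumℚ-reverse (λ i → tℚ (n ℕ.∸ i) * b i) n) ⟩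
      sumℚ (λ i → tℚ (n ℕ.∸ i) * b i) n                   ≡⟨ sumℚ-cong n (λ i _ → sym (fromℤ-* (+ t (n ℕ.∸ i)) (coeffℤ B i))) ⟩
      sumℚ (λ i → fromℤ (+ t (n ℕ.∸ i) ℤ.* coeffℤ B i)) n ≡⟨ sym (fromℤ-sumTo _ n) ⟩
      fromℤ (sumTo (λ i → + t (n ℕ.∸ i) ℤ.* coeffℤ B i) n) ≡⟨ cong fromℤ (gf n) ⟩
      fromℤ (coeffℤ A n)                                  ∎
      where open ≡-Reasoning

    module _ (y : ℚ) where
      private
        term : ℕ → ℕ → ℚ
        term i r = tℚ i * (y ^ℚ i) * evalUpTo B y r

        truncatedProduct : ℕ → ℚ
        truncatedProduct M = sumℚ (λ i → term i (M ℕ.∸ i)) M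

        term-suc : ∀ M i → i ℕ.≤ M → term i (suc M ℕ.∸ i) ≡ term i (M ℕ.∸ i) + tℚ i * b (suc M ℕ.∸ i) * (y ^ℚ suc M)
        term-suc M i i≤M = begin
          term i (suc M ℕ.∸ i)                                                                   ≡⟨ cong (term i) (ℕₚ.+-∸-assoc 1 i≤M) ⟩
          tℚ i * (y ^ℚ i) * (evalUpTo B y (M ℕ.∸ i) + b (suc (M ℕ.∸ i)) * (y ^ℚ suc (M ℕ.∸ i)))
            ≡⟨ distrib (tℚ i) (y ^ℚ i) (evalUpTo B y (M ℕ.∸ i)) (b (suc (M ℕ.∸ i))) (y ^ℚ suc (M ℕ.∸ i)) ⟩
          term i (M ℕ.∸ i) + tℚ i * b (suc (M ℕ.∸ i)) * ((y ^ℚ i) * (y ^ℚ suc (M ℕ.∸ i)))        ≡⟨ cong₂ (λ k p → term i (M ℕ.∸ i) + tℚ i * b k * p)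
                                                                                                     (sym (ℕₚ.+-∸-assoc 1 i≤M)) (sym (^-distribˡ-+-* y i _)) ⟩
          term i (M ℕ.∸ i) + tℚ i * b (suc M ℕ.∸ i) * (y ^ℚ (i ℕ.+ suc (M ℕ.∸ i)))               ≡⟨ cong (λ k → term i (M ℕ.∸ i) + tℚ i * b (suc M ℕ.∸ i) * (y ^ℚ k))
                                                                                                     (trans (ℕₚ.+-suc i _) (cong suc (ℕₚ.m+[n∸m]≡n i≤M))) ⟩
          term i (M ℕ.∸ i) + tℚ i * b (suc M ℕ.∸ i) * (y ^ℚ suc M)                              ∎
          where
          open ≡-Reasoning
          distrib : ∀ a p c b q → a * p * (c + b * q) ≡ a * p * c + a * b * (p * q)
          distrib = solve-∀ ℚ-ring

        truncatedProduct-suc : ∀ M → truncatedProduct (suc M) ≡ truncatedProduct M + fromℤ (coeffℤ A (suc M)) * (y ^ℚ suc M)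
        truncatedProduct-suc M = begin
          sumℚ (λ i → term i (suc M ℕ.∸ i)) M + term (suc M) (M ℕ.∸ M)     ≡⟨ cong₂ _+_ (sumℚ-cong M (term-suc M)) (cong (term (suc M)) (ℕₚ.n∸n≡0 M)) ⟩
          sumℚ (λ i → term i (M ℕ.∸ i) + new i) M + term (suc M) 0         ≡⟨ cong (_+ term (suc M) 0) (sumℚ-+ _ new M) ⟩
          truncatedProduct M + sumℚ new M + term (suc M) 0                 ≡⟨ cong (_+_ (truncatedProduct M + sumℚ new M)) last-term ⟩
          truncatedProduct M + sumℚ new M + new (suc M)                    ≡⟨ ℚₚ.+-assoc (truncatedProduct M) _ _ ⟩
          truncatedProduct M + sumℚ new (suc M)                            ≡⟨ cong (_+_ (truncatedProduct M)) (sym (sumℚ-*ʳ _ (suc M) (y ^ℚ suc M))) ⟩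
          truncatedProduct M + sumℚ (λ i → tℚ i * b (suc M ℕ.∸ i)) (suc M) * (y ^ℚ suc M)
                                                                            ≡⟨ cong (λ z → truncatedProduct M + z * (y ^ℚ suc M)) (convolution (suc M)) ⟩
          truncatedProduct M + fromℤ (coeffℤ A (suc M)) * (y ^ℚ suc M)      ∎
          where
          open ≡-Reasoning
          new : ℕ → ℚ
          new i = tℚ i * b (suc M ℕ.∸ i) * (y ^ℚ suc M)
          last-term : term (suc M) 0 ≡ new (suc M)
          last-term = trans (reorder (tℚ (suc M)) (y ^ℚ suc M) (b 0)) (cong (λ k → tℚ (suc M) * b k * (y ^ℚ suc M)) (sym (ℕₚ.n∸n≡0 M)))
            where
            reorder : ∀ a p b → a * p * (b * 1ℚ) ≡ a * b * p
            reorder = solve-∀ ℚ-ring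

        evalUpTo≡truncatedProduct : ∀ M → evalUpTo A y M ≡ truncatedProduct M
        evalUpTo≡truncatedProduct zero    = trans (cong (_* 1ℚ) (sym (convolution 0))) (reorder (tℚ 0) (b 0))
          where
          reorder : ∀ a b → a * b * 1ℚ ≡ a * 1ℚ * (b * 1ℚ)
          reorder = solve-∀ ℚ-ring
        evalUpTo≡truncatedProduct (suc M) = trans (cong (_+ _) (evalUpTo≡truncatedProduct M)) (sym (truncatedProduct-suc M))

      errorTerm : ℕ → ℕ → ℚ
      errorTerm M i = tℚ i * ((y ^ℚ i) * (y ^ℚ suc (M ℕ.∸ i))) * eval (drop (suc (M ℕ.∸ i)) B) y

      truncationError : ℕ → ℚ
      truncationError M = sumℚ (errorTerm M) M

      truncation : ∀ M → length A ℕ.≤ suc M → eval A y ≡ partialSum t y M * eval B y - truncationError M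
      truncation M len≤ = begin
        eval A y                                                                 ≡⟨ eval≡evalUpTo M A y len≤ ⟩
        evalUpTo A y M                                                           ≡⟨ evalUpTo≡truncatedProduct M ⟩
        truncatedProduct M                                                       ≡⟨ sumℚ-cong M (λ i _ → split-term i) ⟩
        sumℚ (λ i → tℚ i * (y ^ℚ i) * eval B y + - errorTerm M i) M              ≡⟨ sumℚ-+ _ _ M ⟩
        sumℚ (λ i → tℚ i * (y ^ℚ i) * eval B y) M + sumℚ (λ i → - errorTerm M i) M ≡⟨ cong₂ _+_ (sym (sumℚ-*ʳ _ M (eval B y))) (sym (sumℚ-neg (errorTerm M) M)) ⟩
        partialSum t y M * eval B y - truncationError M                          ∎
        where
        open ≡-Reasoning
        cancel : ∀ a p c q e → a * p * (c + q * e) + - (a * (p * q) * e) ≡ a * p * c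
        cancel = solve-∀ ℚ-ring
        split-term : ∀ i → term i (M ℕ.∸ i) ≡ tℚ i * (y ^ℚ i) * eval B y + - errorTerm M i
        split-term i = trans (sym (cancel (tℚ i) (y ^ℚ i) _ _ _))
                             (cong (λ z → tℚ i * (y ^ℚ i) * z + - errorTerm M i) (sym (eval-split (M ℕ.∸ i) B y)))

    ∣truncationError∣≤ : ∀ {y} M → 0ℚ ≤ y → y ≤ 1ℚ → ∣ truncationError y M ∣ ≤ norm₁ B * (y ^ℚ suc M) * fromℕ (digitSum t M)
    ∣truncationError∣≤ {y} M 0≤y y≤1 = begin
      ∣ truncationError y M ∣                              ≤⟨ ∣sumℚ∣≤ _ M ⟩
      sumℚ (λ i → ∣ errorTerm y M i ∣) M                   ≤⟨ sumℚ-mono-≤ M ∣errorTerm∣≤ ⟩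
      sumℚ (λ i → norm₁ B * (y ^ℚ suc M) * tℚ i) M         ≡⟨ sym (sumℚ-*ˡ (norm₁ B * (y ^ℚ suc M)) tℚ M) ⟩
      norm₁ B * (y ^ℚ suc M) * sumℚ tℚ M                   ≡⟨ cong (norm₁ B * (y ^ℚ suc M) *_) (sym (fromℕ-digitSum t M)) ⟩
      norm₁ B * (y ^ℚ suc M) * fromℕ (digitSum t M)        ∎
      where
      open ℚₚ.≤-Reasoning
      ∣y∣≤1 : ∣ y ∣ ≤ 1ℚ
      ∣y∣≤1 = subst (_≤ 1ℚ) (sym (ℚₚ.0≤p⇒∣p∣≡p 0≤y)) y≤1
      0≤tyᴹ : ∀ i → 0ℚ ≤ tℚ i * (y ^ℚ suc M)
      0≤tyᴹ i = *-nonNeg (fromℕ-nonNeg (t i)) (^-nonNeg (suc M) 0≤y)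
      ∣errorTerm∣≤ : ∀ i → i ℕ.≤ M → ∣ errorTerm y M i ∣ ≤ norm₁ B * (y ^ℚ suc M) * tℚ i
      ∣errorTerm∣≤ i i≤M = begin
        ∣ tℚ i * ((y ^ℚ i) * (y ^ℚ suc (M ℕ.∸ i))) * eval tail y ∣  ≡⟨ cong (λ p → ∣ tℚ i * p * eval tail y ∣) powers ⟩
        ∣ tℚ i * (y ^ℚ suc M) * eval tail y ∣                      ≡⟨ trans (ℚₚ.∣p*q∣≡∣p∣*∣q∣ (tℚ i * (y ^ℚ suc M)) (eval tail y)) (cong (_* ∣ eval tail y ∣) (ℚₚ.0≤p⇒∣p∣≡p (0≤tyᴹ i))) ⟩
        tℚ i * (y ^ℚ suc M) * ∣ eval tail y ∣                      ≤⟨ *-monoˡ-≤-0≤ (tℚ i * (y ^ℚ suc M)) (0≤tyᴹ i) (ℚₚ.≤-trans (∣eval∣≤norm₁ tail ∣y∣≤1) (norm₁-drop (suc (M ℕ.∸ i)) B)) ⟩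
        tℚ i * (y ^ℚ suc M) * norm₁ B                              ≡⟨ reorder (tℚ i) (y ^ℚ suc M) (norm₁ B) ⟩
        norm₁ B * (y ^ℚ suc M) * tℚ i                              ∎
        where
        tail = drop (suc (M ℕ.∸ i)) B
        powers : (y ^ℚ i) * (y ^ℚ suc (M ℕ.∸ i)) ≡ y ^ℚ suc M
        powers = trans (sym (^-distribˡ-+-* y i _)) (cong (y ^ℚ_) (trans (ℕₚ.+-suc i _) (cong suc (ℕₚ.m+[n∸m]≡n i≤M))))
        reorder : ∀ a p n → a * p * n ≡ n * p * a
        reorder = solve-∀ ℚ-ring

  module Tail {t : ℕ → ℕ} {n X : ℕ} (tb : TailBounds t n X) where
    open TailBounds tb

    1≤X : 1 ℕ.≤ X
    1≤X = ℕₚ.≤-trans (s≤s z≤n) 4≤X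

    x : ℚ
    x = invℕ X

    0≤x : 0ℚ ≤ x
    0≤x = ℚₚ.<⇒≤ (invℕ-pos 1≤X)

    x≤1 : x ≤ 1ℚ
    x≤1 = invℕ≤1 X

    x^*X^≡1 : ∀ M → (x ^ℚ M) * (fromℕ X ^ℚ M) ≡ 1ℚ
    x^*X^≡1 M = ^-inverse M (invℕ-inverse 1≤X)

    private
      0≤t : ∀ i → 0ℚ ≤ fromℕ (t i)
      0≤t i = fromℕ-nonNeg (t i)

    tailValue : ℕ → ℚ
    tailValue K = fromℕ (horner (tailDigits t n) X K) * (x ^ℚ K)

    tailValue-nonNeg : ∀ K → 0ℚ ≤ tailValue K
    tailValue-nonNeg K = *-nonNeg (fromℕ-nonNeg _) (^-nonNeg K 0≤x)

    3*tailValue≤2 : ∀ K → fromℕ 3 * tailValue K ≤ fromℕ 2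
    3*tailValue≤2 K = begin
      fromℕ 3 * (fromℕ S * (x ^ℚ K))          ≡⟨ trans (sym (ℚₚ.*-assoc (fromℕ 3) (fromℕ S) (x ^ℚ K))) (cong (_* (x ^ℚ K)) (sym (fromℕ-* 3 S))) ⟩
      fromℕ (3 ℕ.* S) * (x ^ℚ K)              ≤⟨ *-monoʳ-≤-0≤ (x ^ℚ K) (^-nonNeg K 0≤x) (fromℕ-mono-≤ (tail-small K)) ⟩
      fromℕ (2 ℕ.* X ℕ.^ K) * (x ^ℚ K)        ≡⟨ cong (_* (x ^ℚ K)) (trans (fromℕ-* 2 (X ℕ.^ K)) (cong (fromℕ 2 *_) (fromℕ-^ X K))) ⟩
      fromℕ 2 * (fromℕ X ^ℚ K) * (x ^ℚ K)     ≡⟨ trans (ℚₚ.*-assoc (fromℕ 2) (fromℕ X ^ℚ K) (x ^ℚ K)) (cong (fromℕ 2 *_) (trans (ℚₚ.*-comm (fromℕ X ^ℚ K) (x ^ℚ K)) (x^*X^≡1 K))) ⟩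
      fromℕ 2 * 1ℚ                            ≡⟨ ℚₚ.*-identityʳ (fromℕ 2) ⟩
      fromℕ 2                                 ∎
      where
      open ℚₚ.≤-Reasoning
      S = horner (tailDigits t n) X K

    tailValue≤1 : ∀ K → tailValue K ≤ 1ℚ
    tailValue≤1 K = ℚₚ.*-cancelˡ-≤-pos (fromℕ 3) (ℚₚ.≤-trans (3*tailValue≤2 K) (fromℕ-mono-≤ (s≤s (s≤s z≤n))))

    partialSum-split : ∀ K → partialSum t x (n ℕ.+ K) ≡ partialSum t x n + (x ^ℚ n) * tailValue K
    partialSum-split zero = trans (cong (partialSum t x) (ℕₚ.+-identityʳ n)) (pad (partialSum t x n) (x ^ℚ n))
      where
      pad : ∀ a p → a ≡ a + p * (0ℚ * 1ℚ)
      pad = solve-∀ ℚ-ring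
    partialSum-split (suc K) = begin
      partialSum t x (n ℕ.+ suc K)                                     ≡⟨ cong (partialSum t x) (ℕₚ.+-suc n K) ⟩
      partialSum t x (n ℕ.+ K) + fromℕ (t (suc (n ℕ.+ K))) * (x ^ℚ suc (n ℕ.+ K))
        ≡⟨ cong₂ _+_ (partialSum-split K) (cong₂ (λ k p → fromℕ (t k) * p) (sym (ℕₚ.+-suc n K))
                                                 (trans (cong (x ^ℚ_) (sym (ℕₚ.+-suc n K))) (^-distribˡ-+-* x n (suc K)))) ⟩
      T + xⁿ * (fromℕ S * xᴷ) + u * (xⁿ * (x * xᴷ))                     ≡⟨ cong (λ z → T + z + u * (xⁿ * (x * xᴷ)))
                                                                               (trans (sym (ℚₚ.*-identityʳ _)) (cong (_*_ (xⁿ * (fromℕ S * xᴷ))) (sym (invℕ-inverse 1≤X)))) ⟩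
      T + xⁿ * (fromℕ S * xᴷ) * (x * fromℕ X) + u * (xⁿ * (x * xᴷ))     ≡⟨ regroup T xⁿ (fromℕ S) (fromℕ X) x xᴷ u ⟩
      T + xⁿ * ((fromℕ X * fromℕ S + u) * (x * xᴷ))                    ≡⟨ cong (λ z → T + xⁿ * (z * (x * xᴷ))) (sym (trans (fromℕ-+ (X ℕ.* S) (t (n ℕ.+ suc K))) (cong (_+ u) (fromℕ-* X S)))) ⟩
      partialSum t x n + (x ^ℚ n) * tailValue (suc K)                  ∎
      where
      open ≡-Reasoning
      T = partialSum t x n
      xⁿ = x ^ℚ n
      xᴷ = x ^ℚ K
      S = horner (tailDigits t n) X K
      u = fromℕ (t (n ℕ.+ suc K))
      regroup : ∀ T p s X x k u → T + p * (s * k) * (x * X) + u * (p * (x * k)) ≡ T + p * ((X * s + u) * (x * k))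
      regroup = solve-∀ ℚ-ring

    horner≡X^*partialSum : ∀ j → fromℕ (horner t X (suc j)) ≡ (fromℕ X ^ℚ j) * partialSum t x j
    horner≡X^*partialSum zero = trans (cong (λ m → fromℕ (m ℕ.+ t 0)) (ℕₚ.*-zeroʳ X)) (units (fromℕ (t 0)))
      where
      units : ∀ a → a ≡ 1ℚ * (a * 1ℚ)
      units = solve-∀ ℚ-ring
    horner≡X^*partialSum (suc j) = begin
      fromℕ (X ℕ.* horner t X (suc j) ℕ.+ t (suc j))             ≡⟨ trans (fromℕ-+ (X ℕ.* horner t X (suc j)) (t (suc j))) (cong (_+ u) (fromℕ-* X (horner t X (suc j)))) ⟩
      fromℕ X * fromℕ (horner t X (suc j)) + u                   ≡⟨ cong (λ z → fromℕ X * z + u) (horner≡X^*partialSum j) ⟩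
      fromℕ X * (Xʲ * T) + u                                     ≡⟨ cong (_+_ (fromℕ X * (Xʲ * T))) (sym (trans (cong (u *_) (x^*X^≡1 (suc j))) (ℚₚ.*-identityʳ u))) ⟩
      fromℕ X * (Xʲ * T) + u * ((x ^ℚ suc j) * (fromℕ X ^ℚ suc j)) ≡⟨ factor (fromℕ X) Xʲ T u x (x ^ℚ j) ⟩
      fromℕ X ^ℚ suc j * partialSum t x (suc j)                  ∎
      where
      open ≡-Reasoning
      u = fromℕ (t (suc j))
      Xʲ = fromℕ X ^ℚ j
      T = partialSum t x j
      factor : ∀ X P T q x p → X * (P * T) + q * (x * p * (X * P)) ≡ X * P * (T + q * (x * p))
      factor = solve-∀ ℚ-ring

    partialSum-nonNeg : ∀ {y} M → 0ℚ ≤ y → 0ℚ ≤ partialSum t y M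
    partialSum-nonNeg M 0≤y = sumℚ-nonNeg M (λ i _ → *-nonNeg (0≤t i) (^-nonNeg i 0≤y))

    private
      partialSum-monoˡ : ∀ {y z} M → 0ℚ ≤ y → y ≤ z → partialSum t y M ≤ partialSum t z M
      partialSum-monoˡ M 0≤y y≤z = sumℚ-mono-≤ M (λ i _ → *-monoˡ-≤-0≤ _ (0≤t i) (^-monoˡ-≤ i 0≤y y≤z))

      partialSum-monoʳ : ∀ {y m} M → 0ℚ ≤ y → m ℕ.≤ M → partialSum t y m ≤ partialSum t y M
      partialSum-monoʳ {y} {m} zero    _   z≤n   = ℚₚ.≤-refl
      partialSum-monoʳ {y} {m} (suc M) 0≤y m≤1+M with ℕₚ.m≤n⇒m<n∨m≡n m≤1+M
      ... | inj₂ refl  = ℚₚ.≤-refl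
      ... | inj₁ m<1+M = ℚₚ.≤-trans (partialSum-monoʳ M 0≤y (ℕₚ.≤-pred m<1+M))
                           (subst (_≤ partialSum t y (suc M)) (ℚₚ.+-identityʳ (partialSum t y M)) (ℚₚ.+-monoʳ-≤ (partialSum t y M) (*-nonNeg (0≤t (suc M)) (^-nonNeg (suc M) 0≤y))))

      partialSum≤digitSum : ∀ {y} M → 0ℚ ≤ y → y ≤ 1ℚ → partialSum t y M ≤ fromℕ (digitSum t M)
      partialSum≤digitSum {y} M 0≤y y≤1 = subst (partialSum t y M ≤_) (sym (fromℕ-digitSum t M))
        (sumℚ-mono-≤ M (λ i _ → subst (fromℕ (t i) * (y ^ℚ i) ≤_) (ℚₚ.*-identityʳ (fromℕ (t i))) (*-monoˡ-≤-0≤ (fromℕ (t i)) (0≤t i) (^-≤1 i 0≤y y≤1))))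

    -- The digits up to n contribute at most digitSum t n, the later ones at most x^n (2/3) ≤ 1.
    partialSum≤ : ∀ {y} M → 0ℚ ≤ y → y ≤ x → partialSum t y M ≤ fromℕ (digitSum t n) + 1ℚ
    partialSum≤ {y} M 0≤y y≤x = ℚₚ.≤-trans (partialSum-monoˡ M 0≤y y≤x) (at-x (M ℕ.≤? n))
      where
      at-x : Dec (M ℕ.≤ n) → partialSum t x M ≤ fromℕ (digitSum t n) + 1ℚ
      at-x (yes M≤n) = ℚₚ.≤-trans (ℚₚ.≤-trans (partialSum-monoʳ n 0≤x M≤n) (partialSum≤digitSum n 0≤x x≤1))
                                  (subst (_≤ fromℕ (digitSum t n) + 1ℚ) (ℚₚ.+-identityʳ (fromℕ (digitSum t n))) (ℚₚ.+-monoʳ-≤ (fromℕ (digitSum t n)) 0≤1))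
      at-x (no  M≰n) = begin
        partialSum t x M                             ≡⟨ cong (partialSum t x) (sym (ℕₚ.m+[n∸m]≡n (ℕₚ.<⇒≤ (ℕₚ.≰⇒> M≰n)))) ⟩
        partialSum t x (n ℕ.+ (M ℕ.∸ n))             ≡⟨ partialSum-split (M ℕ.∸ n) ⟩
        partialSum t x n + (x ^ℚ n) * tailValue K    ≤⟨ ℚₚ.+-mono-≤ (partialSum≤digitSum n 0≤x x≤1)
                                                         (*-mono-≤-0≤ (^-nonNeg n 0≤x) (tailValue-nonNeg K) (^-≤1 n 0≤x x≤1) (tailValue≤1 K)) ⟩
        fromℕ (digitSum t n) + 1ℚ * 1ℚ               ≡⟨ cong (_+_ (fromℕ (digitSum t n))) (ℚₚ.*-identityʳ 1ℚ) ⟩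
        fromℕ (digitSum t n) + 1ℚ                    ∎
        where
        open ℚₚ.≤-Reasoning
        K = M ℕ.∸ n

    digitSum-decay : ∀ {y} M → 0ℚ ≤ y → y ≤ x → (y ^ℚ suc M) * fromℕ (digitSum t M) ≤ fromℕ (growthConst tb) * (½ ^ℚ M)
    digitSum-decay {y} M 0≤y y≤x = begin
      (y ^ℚ suc M) * S                             ≤⟨ *-monoʳ-≤-0≤ S (fromℕ-nonNeg _) (^-monoˡ-≤ (suc M) 0≤y y≤x) ⟩
      x * (x ^ℚ M) * S                             ≤⟨ ℚₚ.≤-reflexive (ℚₚ.*-assoc x (x ^ℚ M) S) ⟩
      x * ((x ^ℚ M) * S)                           ≤⟨ *-monoʳ-≤-0≤ _ xᴹS-nonNeg (ℚₚ.≤-trans x≤1 (fromℕ-mono-≤ (s≤s z≤n))) ⟩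
      fromℕ 2 * ((x ^ℚ M) * S)                     ≡⟨ scale (fromℕ 2) (x ^ℚ M) S (fromℕ 2 ^ℚ M) (½ ^ℚ M) (2^*½^≡1 M) ⟩
      fromℕ 2 * S * (fromℕ 2 ^ℚ M) * ((x ^ℚ M) * (½ ^ℚ M))
        ≤⟨ *-monoʳ-≤-0≤ _ (*-nonNeg (^-nonNeg M 0≤x) (^-nonNeg M (ℚₚ.<⇒≤ (1/suc-pos 1)))) growth ⟩
      fromℕ C * (fromℕ X ^ℚ M) * ((x ^ℚ M) * (½ ^ℚ M))  ≡⟨ cancel (fromℕ C) (fromℕ X ^ℚ M) (x ^ℚ M) (½ ^ℚ M) (x^*X^≡1 M) ⟩
      fromℕ C * (½ ^ℚ M)                           ∎
      where
      open ℚₚ.≤-Reasoning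
      S = fromℕ (digitSum t M)
      C = growthConst tb
      xᴹS-nonNeg : 0ℚ ≤ (x ^ℚ M) * S
      xᴹS-nonNeg = *-nonNeg (^-nonNeg M 0≤x) (fromℕ-nonNeg _)
      growth : fromℕ 2 * S * (fromℕ 2 ^ℚ M) ≤ fromℕ C * (fromℕ X ^ℚ M)
      growth = subst₂ _≤_
        (trans (fromℕ-* (2 ℕ.* digitSum t M) (2 ℕ.^ M)) (cong₂ _*_ (fromℕ-* 2 (digitSum t M)) (fromℕ-^ 2 M)))
        (trans (fromℕ-* C (X ℕ.^ M)) (cong (fromℕ C *_) (fromℕ-^ X M)))
        (fromℕ-mono-≤ (digitSum-growth tb M))
      scale : ∀ a p s q r → q * r ≡ 1ℚ → a * (p * s) ≡ a * s * q * (p * r)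
      scale a p s q r qr≡1 = trans (sym (ℚₚ.*-identityʳ _)) (trans (cong (a * (p * s) *_) (sym qr≡1)) (reorder a p s q r))
        where
        reorder : ∀ a p s q r → a * (p * s) * (q * r) ≡ a * s * q * (p * r)
        reorder = solve-∀ ℚ-ring
      cancel : ∀ k q p r → p * q ≡ 1ℚ → k * q * (p * r) ≡ k * r
      cancel k q p r pq≡1 = trans (reorder k q p r) (trans (cong (λ z → k * (z * r)) pq≡1) (cong (k *_) (ℚₚ.*-identityˡ r)))
        where
        reorder : ∀ k q p r → k * q * (p * r) ≡ k * (p * q * r)
        reorder = solve-∀ ℚ-ring

  module Estimates {t : ℕ → ℕ} (A B : List ℤ) (gf : GFEquals t A B) {n X : ℕ} (tb : TailBounds t n X) where
    open TailBounds tb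
    open Tail tb
    open Truncation {t} A B gf

    C : ℚ
    C = norm₁ B * fromℕ (growthConst tb)

    ∣truncationError∣≤C½^ : ∀ {y} M → 0ℚ ≤ y → y ≤ x → ∣ truncationError y M ∣ ≤ C * (½ ^ℚ M)
    ∣truncationError∣≤C½^ {y} M 0≤y y≤x = begin
      ∣ truncationError y M ∣                          ≤⟨ ∣truncationError∣≤ M 0≤y (ℚₚ.≤-trans y≤x x≤1) ⟩
      norm₁ B * (y ^ℚ suc M) * fromℕ (digitSum t M)    ≡⟨ ℚₚ.*-assoc (norm₁ B) (y ^ℚ suc M) (fromℕ (digitSum t M)) ⟩
      norm₁ B * ((y ^ℚ suc M) * fromℕ (digitSum t M))  ≤⟨ *-monoˡ-≤-0≤ _ (norm₁-nonNeg B) (digitSum-decay M 0≤y y≤x) ⟩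
      norm₁ B * (fromℕ (growthConst tb) * (½ ^ℚ M))    ≡⟨ sym (ℚₚ.*-assoc (norm₁ B) (fromℕ (growthConst tb)) (½ ^ℚ M)) ⟩
      C * (½ ^ℚ M)                                     ∎
      where open ℚₚ.≤-Reasoning

    β : ℚ
    β = eval B x

    Xⁿ : ℚ
    Xⁿ = fromℕ X ^ℚ n

    0≤Xⁿ : 0ℚ ≤ Xⁿ
    0≤Xⁿ = ^-nonNeg n (fromℕ-nonNeg X)

    H : ℕ
    H = horner t X (suc n)

    D : ℚ
    D = Xⁿ * eval A x - fromℕ H * β

    D≡ : ∀ K → length A ℕ.≤ suc (n ℕ.+ K) → D ≡ tailValue K * β - Xⁿ * truncationError x (n ℕ.+ K)
    D≡ K len≤ = begin
      Xⁿ * eval A x - fromℕ H * β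
        ≡⟨ cong₂ (λ a h → Xⁿ * a - h * β) (truncation x (n ℕ.+ K) len≤) (horner≡X^*partialSum n) ⟩
      Xⁿ * (partialSum t x (n ℕ.+ K) * β - e) - Xⁿ * partialSum t x n * β
        ≡⟨ cong (λ T → Xⁿ * (T * β - e) - Xⁿ * partialSum t x n * β) (partialSum-split K) ⟩
      Xⁿ * ((partialSum t x n + (x ^ℚ n) * tailValue K) * β - e) - Xⁿ * partialSum t x n * β
        ≡⟨ regroup Xⁿ (partialSum t x n) (x ^ℚ n) (tailValue K) β e ⟩
      tailValue K * β * ((x ^ℚ n) * Xⁿ) - Xⁿ * e
        ≡⟨ cong (λ z → tailValue K * β * z - Xⁿ * e) (x^*X^≡1 n) ⟩
      tailValue K * β * 1ℚ - Xⁿ * e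
        ≡⟨ cong (_- Xⁿ * e) (ℚₚ.*-identityʳ (tailValue K * β)) ⟩
      tailValue K * β - Xⁿ * e ∎
      where
      open ≡-Reasoning
      e = truncationError x (n ℕ.+ K)
      regroup : ∀ N T p s b e → N * ((T + p * s) * b - e) - N * T * b ≡ s * b * (p * N) - N * e
      regroup = solve-∀ ℚ-ring

    -- D differs from tailValue K · β only by a truncation error, which can be made arbitrarily small.
    bracket : 0ℚ < β → fromℕ H * β ≤ Xⁿ * eval A x × Xⁿ * eval A x < fromℕ (suc H) * β
    bracket 0<β = 0≤q-p⇒p≤q 0≤D , 0<q-p⇒p<q (subst (0ℚ <_) gap≡ (p<q⇒0<q-p D<β))
      where
      approx : ∀ {ε} → 0ℚ < ε → ∃ λ s → 0ℚ ≤ s × fromℕ 3 * s ≤ fromℕ 2 * β × ∣ D - s ∣ ≤ ε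
      approx {ε} 0<ε = tailValue K * β , *-nonNeg (tailValue-nonNeg K) (ℚₚ.<⇒≤ 0<β) , 3s≤2β , ∣D-s∣≤ε
        where
        fine = archimedean-½ (Xⁿ * C) 0<ε (n ℕ.+ length A)
        M = proj₁ fine
        K = M ℕ.∸ n
        n+K≡M : n ℕ.+ K ≡ M
        n+K≡M = ℕₚ.m+[n∸m]≡n (ℕₚ.≤-trans (ℕₚ.m≤m+n n _) (proj₁ (proj₂ fine)))
        len≤ : length A ℕ.≤ suc (n ℕ.+ K)
        len≤ = ℕₚ.m≤n⇒m≤1+n (subst (length A ℕ.≤_) (sym n+K≡M) (ℕₚ.≤-trans (ℕₚ.m≤n+m _ n) (proj₁ (proj₂ fine))))
        3s≤2β : fromℕ 3 * (tailValue K * β) ≤ fromℕ 2 * β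
        3s≤2β = subst₂ _≤_ (ℚₚ.*-assoc (fromℕ 3) (tailValue K) β) refl (*-monoʳ-≤-0≤ β (ℚₚ.<⇒≤ 0<β) (3*tailValue≤2 K))
        ∣D-s∣≤ε : ∣ D - tailValue K * β ∣ ≤ ε
        ∣D-s∣≤ε = begin
          ∣ D - tailValue K * β ∣                 ≡⟨ cong (λ d → ∣ d - tailValue K * β ∣) (D≡ K len≤) ⟩
          ∣ tailValue K * β - Xⁿ * e - tailValue K * β ∣ ≡⟨ cong ∣_∣ (cancel (tailValue K * β) (Xⁿ * e)) ⟩
          ∣ - (Xⁿ * e) ∣                          ≡⟨ trans (ℚₚ.∣-p∣≡∣p∣ _) (trans (ℚₚ.∣p*q∣≡∣p∣*∣q∣ Xⁿ e) (cong (_* ∣ e ∣) (ℚₚ.0≤p⇒∣p∣≡p 0≤Xⁿ))) ⟩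
          Xⁿ * ∣ e ∣                              ≤⟨ *-monoˡ-≤-0≤ Xⁿ 0≤Xⁿ (∣truncationError∣≤C½^ (n ℕ.+ K) 0≤x ℚₚ.≤-refl) ⟩
          Xⁿ * (C * (½ ^ℚ (n ℕ.+ K)))             ≡⟨ trans (sym (ℚₚ.*-assoc Xⁿ C (½ ^ℚ (n ℕ.+ K)))) (cong (λ m → Xⁿ * C * (½ ^ℚ m)) n+K≡M) ⟩
          Xⁿ * C * (½ ^ℚ M)                       ≤⟨ proj₂ (proj₂ fine) ⟩
          ε                                       ∎
          where
          open ℚₚ.≤-Reasoning
          e = truncationError x (n ℕ.+ K)
          cancel : ∀ s r → s - r - s ≡ - r
          cancel = solve-∀ ℚ-ring
      0≤D = proj₁ (squeeze 0<β approx)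
      D<β = proj₂ (squeeze 0<β approx)
      rearrange : ∀ a h b → b - (a - h * b) ≡ (1ℚ + h) * b - a
      rearrange = solve-∀ ℚ-ring
      gap≡ : β - D ≡ fromℕ (suc H) * β - Xⁿ * eval A x
      gap≡ = trans (rearrange (Xⁿ * eval A x) (fromℕ H) β) (cong (λ z → z * β - Xⁿ * eval A x) (sym (fromℕ-+ 1 H)))

    module _ (bz : Bezout A B) where
      open Bezout bz

      Λ : ℚ
      Λ = norm₁ U * (fromℕ (digitSum t n) + 1ℚ) + norm₁ V + 1ℚ

      0<Λ : 0ℚ < Λ
      0<Λ = ℚₚ.≤-<-trans (+-nonNeg (*-nonNeg (norm₁-nonNeg U) (+-nonNeg (fromℕ-nonNeg (digitSum t n)) 0≤1)) (norm₁-nonNeg V))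
                         (subst (_< Λ) (ℚₚ.+-identityʳ Λ₀) (ℚₚ.+-monoʳ-< Λ₀ 0<1))
        where
        Λ₀ = norm₁ U * (fromℕ (digitSum t n) + 1ℚ) + norm₁ V

      -- N = U A + V B = B (U T + V) - U e, where the truncation T of the series is bounded and the error e is small.
      B-bounded-below : ∀ y → 0ℚ ≤ y → y ≤ x → ½ ≤ ∣ eval B y ∣ * Λ
      B-bounded-below y 0≤y y≤x = subst₂ _≤_ 1-½≡½ (minus-half _) (ℚₚ.+-monoˡ-≤ (- ½) 1≤∣B∣Λ+½)
        where
        fine = archimedean-½ (norm₁ U * C) (1/suc-pos 1) (length A)
        M = proj₁ fine
        ∣y∣≤1 : ∣ y ∣ ≤ 1ℚ
        ∣y∣≤1 = subst (_≤ 1ℚ) (sym (ℚₚ.0≤p⇒∣p∣≡p 0≤y)) (ℚₚ.≤-trans y≤x x≤1)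
        u = eval U y
        v = eval V y
        T = partialSum t y M
        e = truncationError y M
        N≡ : fromℤ N ≡ eval B y * (u * T + v) - u * e
        N≡ = trans (sym (identity y)) (trans (cong (λ a → u * a + v * eval B y) (truncation y M (ℕₚ.m≤n⇒m≤1+n (proj₁ (proj₂ fine)))))
                                             (regroup u T (eval B y) e v))
          where
          regroup : ∀ u T b e v → u * (T * b - e) + v * b ≡ b * (u * T + v) - u * e
          regroup = solve-∀ ℚ-ring
        ∣uT+v∣≤Λ : ∣ u * T + v ∣ ≤ Λ
        ∣uT+v∣≤Λ = begin
          ∣ u * T + v ∣                                  ≤⟨ ℚₚ.∣p+q∣≤∣p∣+∣q∣ (u * T) v ⟩
          ∣ u * T ∣ + ∣ v ∣                              ≡⟨ cong (_+ ∣ v ∣) (trans (ℚₚ.∣p*q∣≡∣p∣*∣q∣ u T) (cong (∣ u ∣ *_) (ℚₚ.0≤p⇒∣p∣≡p (partialSum-nonNeg M 0≤y)))) ⟩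
          ∣ u ∣ * T + ∣ v ∣                              ≤⟨ ℚₚ.+-mono-≤ (*-mono-≤-0≤ (ℚₚ.0≤∣p∣ u) (partialSum-nonNeg M 0≤y) (∣eval∣≤norm₁ U ∣y∣≤1) (partialSum≤ M 0≤y y≤x))
                                                                         (∣eval∣≤norm₁ V ∣y∣≤1) ⟩
          norm₁ U * (fromℕ (digitSum t n) + 1ℚ) + norm₁ V ≤⟨ subst (_≤ Λ) (ℚₚ.+-identityʳ Λ₀) (ℚₚ.+-monoʳ-≤ Λ₀ 0≤1) ⟩
          Λ                                              ∎
          where
          open ℚₚ.≤-Reasoning
          Λ₀ = norm₁ U * (fromℕ (digitSum t n) + 1ℚ) + norm₁ V
        ∣ue∣≤½ : ∣ u * e ∣ ≤ ½
        ∣ue∣≤½ = begin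
          ∣ u * e ∣                     ≡⟨ ℚₚ.∣p*q∣≡∣p∣*∣q∣ u e ⟩
          ∣ u ∣ * ∣ e ∣                 ≤⟨ *-mono-≤-0≤ (ℚₚ.0≤∣p∣ u) (ℚₚ.0≤∣p∣ e) (∣eval∣≤norm₁ U ∣y∣≤1) (∣truncationError∣≤C½^ M 0≤y y≤x) ⟩
          norm₁ U * (C * (½ ^ℚ M))      ≡⟨ sym (ℚₚ.*-assoc (norm₁ U) C (½ ^ℚ M)) ⟩
          norm₁ U * C * (½ ^ℚ M)        ≤⟨ proj₂ (proj₂ fine) ⟩
          ½                             ∎
          where open ℚₚ.≤-Reasoning
        1≤∣N∣ : 1ℚ ≤ ∣ fromℤ N ∣
        1≤∣N∣ = fromℕ-mono-≤ (1≤∣i∣ N≢0)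
        1≤∣B∣Λ+½ : 1ℚ ≤ ∣ eval B y ∣ * Λ + ½
        1≤∣B∣Λ+½ = begin
          1ℚ                                               ≤⟨ 1≤∣N∣ ⟩
          ∣ fromℤ N ∣                                      ≡⟨ cong ∣_∣ N≡ ⟩
          ∣ eval B y * (u * T + v) - u * e ∣               ≤⟨ ℚₚ.∣p+q∣≤∣p∣+∣q∣ (eval B y * (u * T + v)) (- (u * e)) ⟩
          ∣ eval B y * (u * T + v) ∣ + ∣ - (u * e) ∣       ≡⟨ cong₂ _+_ (ℚₚ.∣p*q∣≡∣p∣*∣q∣ (eval B y) (u * T + v)) (ℚₚ.∣-p∣≡∣p∣ (u * e)) ⟩
          ∣ eval B y ∣ * ∣ u * T + v ∣ + ∣ u * e ∣         ≤⟨ ℚₚ.+-mono-≤ (*-monoˡ-≤-0≤ ∣ eval B y ∣ (ℚₚ.0≤∣p∣ (eval B y)) ∣uT+v∣≤Λ) ∣ue∣≤½ ⟩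
          ∣ eval B y ∣ * Λ + ½                             ∎
          where open ℚₚ.≤-Reasoning
        minus-half : ∀ a → a + ½ - ½ ≡ a
        minus-half = solve-∀ ℚ-ring
        1-½≡½ : 1ℚ - ½ ≡ ½
        1-½≡½ = refl

      0<β : + 0 ℤ.< coeffℤ B 0 → 0ℚ < β
      0<β 0<b₀ = positive-throughout B 0≤x x≤1 (1/suc-pos 1) 0<Λ B-bounded-below
                   (subst (0ℚ ≤_) (sym (eval-0 B)) (fromℤ-mono-≤ (ℤₚ.<⇒≤ 0<b₀)))

  private
    /-unique : ∀ {a D H} .{{_ : ℕ.NonZero D}} → H ℕ.* D ℕ.≤ a → a ℕ.< suc H ℕ.* D → a ℕ./ D ≡ H
    /-unique {a} {D} {H} HD≤a a<[1+H]D =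
      ℕₚ.≤-antisym (ℕₚ.≤-pred (ℕD.m<n*o⇒m/o<n a<[1+H]D)) (subst (ℕ._≤ a ℕ./ D) (ℕD.m*n/n≡m H D) (ℕD./-monoˡ-≤ D HD≤a))

  floor-unique : ∀ {r H} → fromℕ H ≤ r → r < fromℕ (suc H) → ℚ.floor r ≡ + H
  floor-unique {mkℚ (+ a) d _} {H} (ℚ.*≤* H≤r) (ℚ.*<* r<1+H) =
    trans (ℤₚ.*-identityˡ (+ (a ℕ./ suc d))) (cong +_ (/-unique H*d≤a a<[1+H]*d))
    where
    H*d≤a : H ℕ.* suc d ℕ.≤ a
    H*d≤a = ℤₚ.drop‿+≤+ (subst₂ ℤ._≤_ (sym (ℤₚ.pos-* H (suc d))) (ℤₚ.*-identityʳ (+ a)) H≤r)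
    a<[1+H]*d : a ℕ.< suc H ℕ.* suc d
    a<[1+H]*d = ℤₚ.drop‿+<+ (subst₂ ℤ._<_ (ℤₚ.*-identityʳ (+ a)) (sym (ℤₚ.pos-* (suc H) (suc d))) r<1+H)
  floor-unique {mkℚ -[1+ a ] d _} {H} (ℚ.*≤* H≤r) _ with subst₂ ℤ._≤_ (sym (ℤₚ.pos-* H (suc d))) (ℤₚ.*-identityʳ -[1+ a ]) H≤r
  ... | ()

  floorDiv-unique : ∀ {p q H} → 0ℚ < q → fromℕ H * q ≤ p → p < fromℕ (suc H) * q → floorDiv p q ≡ + H
  floorDiv-unique {p} {mkℚ (+ zero) _ _}   (ℚ.*<* (ℤ.+<+ ())) _ _
  floorDiv-unique {p} {mkℚ -[1+ _ ] _ _}   (ℚ.*<* ())         _ _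
  floorDiv-unique {p} {q@(mkℚ (+ suc _) _ _)} {H} _ Hq≤p p<[1+H]q = floor-unique
    (subst (_≤ p * 1/q) (cancel (fromℕ H)) (*-monoʳ-≤-0≤ 1/q (ℚₚ.<⇒≤ (ℚₚ.positive⁻¹ 1/q {{ℚₚ.1/pos⇒pos q}})) Hq≤p))
    (subst (p * 1/q <_) (cancel (fromℕ (suc H))) (ℚₚ.*-monoˡ-<-pos 1/q {{ℚₚ.1/pos⇒pos q}} p<[1+H]q))
    where
    1/q = ℚ.1/ q
    cancel : ∀ r → r * q * 1/q ≡ r
    cancel r = trans (ℚₚ.*-assoc r q 1/q) (trans (cong (r *_) (trans (ℚₚ.*-comm q 1/q) (ℚₚ.*-inverseˡ q))) (ℚₚ.*-identityʳ r))

  modℤ-digit : ∀ X q d → d ℕ.< X → modℤ (+ (X ℕ.* q ℕ.+ d)) X ≡ + d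
  modℤ-digit (suc k) q d d<X = cong +_ (trans (cong (ℕ._% suc k) (trans (ℕₚ.+-comm (suc k ℕ.* q) d) (cong (d ℕ.+_) (ℕₚ.*-comm (suc k) q))))
                                              (trans (ℕD.[m+kn]%n≡m%n d q (suc k)) (ℕD.m<n⇒m%n≡m d<X)))

  module _ (A₊ A₋ B₊ B₋ : List ℕ) (n b : ℕ) where
    X = b ℕ.^ n
    x = invℕ X
    α = eval (polySub A₊ A₋) x
    β = eval (polySub B₊ B₋) x

    -- E scales numerator and denominator by the same power X^h (h = deg(B₊ - B₋)), which the floor ignores.
    E≡digit : ∀ {q d} → d ℕ.< X → 0ℚ < β →
              fromℕ (X ℕ.* q ℕ.+ d) * β ≤ (fromℕ X ^ℚ n) * α → (fromℕ X ^ℚ n) * α < fromℕ (suc (X ℕ.* q ℕ.+ d)) * β →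
              E A₊ A₋ B₊ B₋ n b ≡ + d
    E≡digit {q} {d} d<X 0<β lower upper = begin
      modℤ (floorDiv num den) X              ≡⟨ cong (λ z → modℤ z X) (cong₂ floorDiv num≡ den≡) ⟩
      modℤ (floorDiv (Xʰ * (Xⁿ * α)) (Xʰ * β)) X ≡⟨ cong (λ z → modℤ z X) (floorDiv-unique (*-pos 0<Xʰ 0<β) scaled scaled′) ⟩
      modℤ (+ (X ℕ.* q ℕ.+ d)) X             ≡⟨ modℤ-digit X q d d<X ⟩
      + d                                    ∎
      where
      open ≡-Reasoning
      h = degℤ (polySub B₊ B₋)
      Xⁿ = fromℕ X ^ℚ n
      Xʰ = fromℕ X ^ℚ h
      0<X : 0ℚ < fromℕ X
      0<X = fromℕ-mono-< (ℕₚ.≤-<-trans z≤n d<X)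
      0<Xʰ : 0ℚ < Xʰ
      0<Xʰ = ^-pos h 0<X
      numScale = fromℕℚ (b ℕ.^ (n ℕ.* n ℕ.+ h ℕ.* n))
      denScale = fromℕℚ (b ℕ.^ (h ℕ.* n))
      num = (numScale * evalℚ A₊ x - numScale * evalℚ A₋ x) ⊔ 0ℚ
      den = (denScale * evalℚ B₊ x - denScale * evalℚ B₋ x) ⊔ 0ℚ
      b^≡X^ : ∀ e → fromℕℚ (b ℕ.^ (n ℕ.* e)) ≡ fromℕ X ^ℚ e
      b^≡X^ e = trans (fromℕℚ≡fromℕ _) (trans (cong fromℕ (sym (ℕₚ.^-*-assoc b n e))) (fromℕ-^ X e))
      difference : ∀ r P₊ P₋ → r * evalℚ P₊ x - r * evalℚ P₋ x ≡ r * eval (polySub P₊ P₋) x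
      difference r P₊ P₋ = trans (factor r (evalℚ P₊ x) (evalℚ P₋ x)) (cong (r *_) (evalℚ-polySub P₊ P₋ x))
        where
        factor : ∀ r a c → r * a - r * c ≡ r * (a - c)
        factor = solve-∀ ℚ-ring
      0≤α : 0ℚ ≤ α
      0≤α = ℚₚ.*-cancelˡ-≤-pos Xⁿ {{ℚ.positive (^-pos n 0<X)}}
              (subst (_≤ Xⁿ * α) (sym (ℚₚ.*-zeroʳ Xⁿ)) (ℚₚ.≤-trans (*-nonNeg (fromℕ-nonNeg _) (ℚₚ.<⇒≤ 0<β)) lower))
      num≡ : num ≡ Xʰ * (Xⁿ * α)
      num≡ = trans (cong (_⊔ 0ℚ) (trans (difference numScale A₊ A₋) (trans (cong (_* α) power≡) (reassoc Xⁿ Xʰ α))))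
                   (ℚₚ.p≥q⇒p⊔q≡p (*-nonNeg (ℚₚ.<⇒≤ 0<Xʰ) (*-nonNeg (ℚₚ.<⇒≤ (^-pos n 0<X)) 0≤α)))
        where
        distrib : ∀ n h → n ℕ.* n ℕ.+ h ℕ.* n ≡ n ℕ.* (n ℕ.+ h)
        distrib = ℕ-solve
        power≡ : numScale ≡ Xⁿ * Xʰ
        power≡ = trans (cong (λ e → fromℕℚ (b ℕ.^ e)) (distrib n h)) (trans (b^≡X^ (n ℕ.+ h)) (^-distribˡ-+-* (fromℕ X) n h))
        reassoc : ∀ a c e → a * c * e ≡ c * (a * e)
        reassoc = solve-∀ ℚ-ring
      den≡ : den ≡ Xʰ * β
      den≡ = trans (cong (_⊔ 0ℚ) (trans (difference denScale B₊ B₋) (cong (_* β) power≡)))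
                   (ℚₚ.p≥q⇒p⊔q≡p (ℚₚ.<⇒≤ (*-pos 0<Xʰ 0<β)))
        where
        power≡ : denScale ≡ Xʰ
        power≡ = trans (cong (λ e → fromℕℚ (b ℕ.^ e)) (ℕₚ.*-comm h n)) (b^≡X^ h)
      swap : ∀ a c e → a * (c * e) ≡ c * (a * e)
      swap = solve-∀ ℚ-ring
      scaled : fromℕ (X ℕ.* q ℕ.+ d) * (Xʰ * β) ≤ Xʰ * (Xⁿ * α)
      scaled = subst (_≤ Xʰ * (Xⁿ * α)) (swap Xʰ (fromℕ (X ℕ.* q ℕ.+ d)) β) (*-monoˡ-≤-0≤ Xʰ (ℚₚ.<⇒≤ 0<Xʰ) lower)
      scaled′ : Xʰ * (Xⁿ * α) < fromℕ (suc (X ℕ.* q ℕ.+ d)) * (Xʰ * β)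
      scaled′ = subst (Xʰ * (Xⁿ * α) <_) (swap Xʰ (fromℕ (suc (X ℕ.* q ℕ.+ d))) β)
                      (ℚₚ.*-monoʳ-<-pos Xʰ {{ℚ.positive 0<Xʰ}} upper)

  0<coeff₀ : ∀ P Q → coeffℕ Q 0 ℕ.< coeffℕ P 0 → + 0 ℤ.< coeffℤ (polySub P Q) 0
  0<coeff₀ []      []      ()
  0<coeff₀ []      (_ ∷ _) ()
  0<coeff₀ (a ∷ P) []      b<a = ℤ.+<+ b<a
  0<coeff₀ (a ∷ P) (b ∷ Q) b<a = subst (+ 0 ℤ.<_) (sym (trans (ℤₚ.[+m]-[+n]≡m⊖n a b) (ℤₚ.⊖-≥ (ℕₚ.<⇒≤ b<a)))) (ℤ.+<+ (ℕₚ.m<n⇒0<n∸m b<a))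

  digit-extraction : ∀ {t} A₊ A₋ B₊ B₋ {n b} →
    GFEquals t (polySub A₊ A₋) (polySub B₊ B₋) → IrreducibleFraction (polySub A₊ A₋) (polySub B₊ B₋) →
    coeffℕ B₋ 0 ℕ.< coeffℕ B₊ 0 → TailBounds t n (b ℕ.^ n) → E A₊ A₋ B₊ B₋ n b ≡ + t n
  digit-extraction A₊ A₋ B₊ B₋ gf irreducible b₋<b₊ tb =
    E≡digit A₊ A₋ B₊ B₋ _ _ (TailBounds.head<X tb) 0<B[x] (proj₁ (bracket 0<B[x])) (proj₂ (bracket 0<B[x]))
    where
    open Estimates (polySub A₊ A₋) (polySub B₊ B₋) gf tb using (bracket; 0<β)
    0<b₀ = 0<coeff₀ B₊ B₋ b₋<b₊
    0<B[x] = 0<β (bezout (polySub A₊ A₋) (polySub B₊ B₋) 0<b₀ irreducible) 0<b₀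

open DigitExtraction using (digit-extraction)
open import Data.Nat using (_≤_; _<_; _∸_; _^_)

theorem5p4 : (t : ℕ → ℕ) (s : ℕ → ℤ) (b₁ b₂ c m : ℕ) (A₊ A₋ B₊ B₋ : List ℕ) →
    2 ≤ b₁ → 8 ≤ b₂ → 2 ≤ m →
    Σ ℕ (λ n → 0 < t n) →
    (∀ r → + t r ≡ s r ℤ.+ + (c ^ (ℕ.suc r))) →
    GFEquals t (polySub A₊ A₋) (polySub B₊ B₋) →
    IrreducibleFraction (polySub A₊ A₋) (polySub B₊ B₋) →
    coeffℕ B₋ 0 < coeffℕ B₊ 0 →
    ((LessThanRadius (invℕ (b₁ ^ m)) t →
    (∀ r → m ≤ r → t r < b₁ ^ (r ∸ 2)) →
    ∀ r → m ≤ r → s r ≡ E A₊ A₋ B₊ B₋ r b₁ ℤ.- + (c ^ (ℕ.suc r)))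
    ×
    (LessThanRadius (invℕ b₂) t →
    (∀ r → 1 ≤ r → t r ^ 3 < b₂ ^ r) →
    ∀ r → 1 ≤ r → s r ≡ E A₊ A₋ B₊ B₋ r b₂ ℤ.- + (c ^ (ℕ.suc r))))
theorem5p4 t s b₁ b₂ c m A₊ A₋ B₊ B₋ 2≤b₁ 8≤b₂ 2≤m _ t≡s+c^ gf irreducible b₋<b₊ = part₁ , part₂
  where
  s≡E-c^ : ∀ {r b} → TailBounds t r (b ^ r) → s r ≡ E A₊ A₋ B₊ B₋ r b ℤ.- + (c ^ suc r)
  s≡E-c^ {r} {b} tb = begin
    s r                                        ≡⟨ a≡a+k-k (s r) (+ (c ^ suc r)) ⟩
    s r ℤ.+ + (c ^ suc r) ℤ.- + (c ^ suc r)    ≡⟨ cong (ℤ._- + (c ^ suc r)) (sym (t≡s+c^ r)) ⟩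
    + t r ℤ.- + (c ^ suc r)                    ≡⟨ cong (ℤ._- + (c ^ suc r)) (sym (digit-extraction A₊ A₋ B₊ B₋ gf irreducible b₋<b₊ tb)) ⟩
    E A₊ A₋ B₊ B₋ r b ℤ.- + (c ^ suc r)        ∎
    where
    open ≡-Reasoning
    a≡a+k-k : ∀ a k → a ≡ a ℤ.+ k ℤ.- k
    a≡a+k-k = ℤ-solve
  part₁ : LessThanRadius (invℕ (b₁ ^ m)) t → (∀ r → m ≤ r → t r < b₁ ^ (r ∸ 2)) →
          ∀ r → m ≤ r → s r ≡ E A₊ A₋ B₊ B₋ r b₁ ℤ.- + (c ^ suc r)
  part₁ _ t<b₁^ r m≤r = s≡E-c^ (tailBounds₁ 2≤b₁ (ℕₚ.≤-trans 2≤m m≤r) (λ r′ r≤r′ → t<b₁^ r′ (ℕₚ.≤-trans m≤r r≤r′)))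
  part₂ : LessThanRadius (invℕ b₂) t → (∀ r → 1 ≤ r → t r ^ 3 < b₂ ^ r) →
          ∀ r → 1 ≤ r → s r ≡ E A₊ A₋ B₊ B₋ r b₂ ℤ.- + (c ^ suc r)
  part₂ _ t³<b₂^ r 1≤r = s≡E-c^ (tailBounds₂ 8≤b₂ 1≤r t³<b₂^)
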